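{- If $G_1$ and $G_2$ are cospectral with respect to $L^{(q)}$, then $G_1\circ_VH$ is cospectral with $G_2\circ_VH$ for any $H$ with respect to $L^{(q)}$.
   Context: All graphs are simple and undirected. For fixed $q$, the $q$-Laplacian $L^{(q)}_G$ has $(u,v)$ entry $q\deg_G(u)$ if $u=v$, $1$ if $u,v$ adjacent, $0$ otherwise. $V$ denotes the full vertex set of $G_1$ (and $G_2$). For a rooted graph $H$, $G\circ_V H$ is the graph obtained from the disjoint union of $G$ and $|V|$ copies of $H$ by identifying, for each $v\in V$, the root of a distinct copy of $H$ with $v$ (i.e., the same graph $H$ is coalesced onto every vertex). -}

module Defs where

open import Level using (Level)
open import Data.Nat as ℕ using (ℕ; zero; suc)
open import Data.Fin as Fin using (Fin; zero; suc; toℕ; punchIn; splitAt; remQuot)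
open import Data.Fin.Properties using (_≟_)
open import Data.Bool using (Bool; true; false; _∧_; if_then_else_)
open import Data.Sum using (_⊎_; inj₁; inj₂)
open import Data.Product using (_×_; _,_)
open import Relation.Nullary.Decidable using (⌊_⌋)
open import Relation.Binary.PropositionalEquality using (_≡_)
open import Algebra.Bundles using (CommutativeRing; RawRing)

Graph : ℕ → Set
Graph n = Fin n → Fin n → Bool

IsSimple : ∀ {n} → Graph n → Set
IsSimple {n} G = (∀ (u v : Fin n) → G u v ≡ G v u) × (∀ (v : Fin n) → G v v ≡ false)

Σℕ : ∀ n → (Fin n → ℕ) → ℕ
Σℕ zero    f = 0
Σℕ (suc n) f = f zero ℕ.+ Σℕ n (λ i → f (suc i))

boolToℕ : Bool → ℕ
boolToℕ true  = 1
boolToℕ false = 0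

deg : ∀ {n} → Graph n → Fin n → ℕ
deg {n} G u = Σℕ n (λ v → boolToℕ (G u v))

-- H is rooted with vertex set Fin (suc m) and root
-- zero.  Vertices of G ∘_V H are Fin (n + n * m):
--   inj₁ v            (via splitAt)  : vertex v of G (= root of copy v of H)
--   inj₂ j, remQuot m j = (v , k)    : non-root vertex (suc k) of copy v of H

data CVert (n m : ℕ) : Set where
  base : Fin n → CVert n m
  copy : Fin n → Fin m → CVert n m

classify : ∀ {n m} → Fin (n ℕ.+ n ℕ.* m) → CVert n m
classify {n} {m} i with splitAt n i
... | inj₁ v = base v
... | inj₂ j with remQuot {n} m j
...   | (v , k) = copy v k

eqF : ∀ {n} → Fin n → Fin n → Bool
eqF a b = ⌊ a ≟ b ⌋

adjC : ∀ {n m} → Graph n → Graph (suc m) → CVert n m → CVert n m → Bool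
adjC G H (base v)   (base w)   = G v w
adjC G H (base v)   (copy w l) = eqF v w ∧ H zero (suc l)
adjC G H (copy v k) (base w)   = eqF v w ∧ H (suc k) zero
adjC G H (copy v k) (copy w l) = eqF v w ∧ H (suc k) (suc l)

coalesce : ∀ {n m} → Graph n → Graph (suc m) → Graph (n ℕ.+ n ℕ.* m)
coalesce G H i j = adjC G H (classify i) (classify j)

module RawDet {c ℓ} (S : RawRing c ℓ) where
  open RawRing S

  Σ : ∀ n → (Fin n → Carrier) → Carrier
  Σ zero    f = 0#
  Σ (suc n) f = f zero + Σ n (λ i → f (suc i))

  altΣ : ∀ n → (Fin n → Carrier) → Carrier
  altΣ zero    f = 0#
  altΣ (suc n) f = f zero + (- altΣ n (λ i → f (suc i)))

  det : ∀ n → (Fin n → Fin n → Carrier) → Carrier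
  det zero    M = 1#
  det (suc n) M = altΣ (suc n) (λ j → M zero j * det n (λ a b → M (suc a) (punchIn j b)))

module _ {c ℓ} (R : CommutativeRing c ℓ) where
  open CommutativeRing R using (Carrier; _≈_; _+_; _*_; -_; 0#; 1#)

  fromℕ : ℕ → Carrier
  fromℕ zero    = 0#
  fromℕ (suc k) = 1# + fromℕ k

  qLaplacian : ∀ {n} → Carrier → Graph n → Fin n → Fin n → Carrier
  qLaplacian q G u v =
    if eqF u v then q * fromℕ (deg G u) else (if G u v then 1# else 0#)

  -- Formal power series R[[x]] as coefficient sequences (a raw ring);
  -- polynomials in x are those with finitely many nonzero coefficients.
  Series : Set c
  Series = ℕ → Carrier

  private
    sumR : ∀ n → (Fin n → Carrier) → Carrier
    sumR zero    f = 0#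
    sumR (suc n) f = f zero + sumR n (λ i → f (suc i))

  conv : Series → Series → Series
  conv f g k = sumR (suc k) (λ i → f (toℕ i) * g (k ℕ.∸ toℕ i))

  SeriesRing : RawRing c ℓ
  SeriesRing = record
    { Carrier = Series
    ; _≈_ = λ f g → ∀ k → f k ≈ g k
    ; _+_ = λ f g k → f k + g k
    ; _*_ = conv
    ; -_  = λ f k → - f k
    ; 0#  = λ _ → 0#
    ; 1#  = λ { zero → 1# ; (suc _) → 0# }
    }

  const : Carrier → Series
  const a zero    = a
  const a (suc _) = 0#

  X : Series
  X zero          = 0#
  X (suc zero)    = 1#
  X (suc (suc _)) = 0#

  charPoly : ∀ n → (Fin n → Fin n → Carrier) → Series
  charPoly n M = RawDet.det SeriesRing n
    (λ i j → if eqF i j then (λ k → X k + (- const (M i j) k))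
                         else (λ k → - const (M i j) k))

  QCospectral : ∀ {n} → Carrier → Graph n → Graph n → Set ℓ
  QCospectral {n} q G G' =
    ∀ (k : ℕ) → charPoly n (qLaplacian q G) k ≈ charPoly n (qLaplacian q G') k

{-# OPTIONS --safe #-}
module Submission where

-- List the vertices of G ∘_V H as V followed by the n copies of H minus its root.  Writing
-- xI − L_H = [[x − q·d, βᵀ], [γ, P]] with the root first (d the root degree), the matrix
-- xI − L(G ∘_V H) has blocks  xI − L_G − q·d·I,  I ⊗ βᵀ,  I ⊗ γ  and  I ⊗ P.  Column operations
-- that only multiply by p = det P (Cramer's rule without division) clear the I ⊗ γ blocks, so
--   pⁿ · χ(G ∘_V H) = det(u·I − p·L_G) · pⁿ,   u = p·(x − q·d) − βᵀ adj(P) γ.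
-- The middle factor is the homogenisation of χ(G) evaluated at (u, p), hence is determined by χ(G);
-- and p is monic, so the factor pⁿ cancels.

open import Data.Nat as ℕ using (ℕ; zero; suc; _<ᵇ_)
import Data.Nat.Properties as ℕ
open import Data.Fin as Fin using (Fin; zero; suc; toℕ; punchIn; punchOut; _↑ˡ_; _↑ʳ_; combine; splitAt)
open import Data.Fin.Properties
  using (_≟_; suc-injective; punchIn-injective; punchInᵢ≢i; punchIn-punchOut; toℕ-injective; toℕ-fromℕ<;
         splitAt-↑ˡ; splitAt-↑ʳ; splitAt⁻¹-↑ˡ; splitAt⁻¹-↑ʳ; join-splitAt; remQuot-combine; combine-remQuot; combine-surjective)
open import Data.Bool using (Bool; true; false; _∧_; if_then_else_)
open import Data.Sum using (inj₁; inj₂; [_,_]′)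
open import Data.Product using (_×_; _,_; proj₁; proj₂)
open import Data.Empty using (⊥-elim)
open import Function using (_∘_)
open import Relation.Nullary using (Dec; yes; no)
import Relation.Binary.PropositionalEquality as ≡
open ≡ using (_≡_; _≢_)
open import Algebra.Bundles using (CommutativeRing; CommutativeSemiring; RawRing)
import Algebra.Properties.Ring
import Algebra.Solver.Ring.NaturalCoefficients.Default
import Relation.Binary.Reasoning.Setoid
open import Defs

eqF-refl : ∀ {n} (i : Fin n) → eqF i i ≡ true
eqF-refl i with i ≟ i
... | yes _ = ≡.refl
... | no i≢i = ⊥-elim (i≢i ≡.refl)

eqF-≢ : ∀ {n} {i j : Fin n} → i ≢ j → eqF i j ≡ false
eqF-≢ {i = i} {j} i≢j with i ≟ j
... | yes i≡j = ⊥-elim (i≢j i≡j)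
... | no _ = ≡.refl

eqF-injective : ∀ {a b} {f : Fin a → Fin b} → (∀ {x y} → f x ≡ f y → x ≡ y) →
                ∀ x y → eqF (f x) (f y) ≡ eqF x y
eqF-injective {f = f} f-inj x y with x ≟ y
... | yes ≡.refl = eqF-refl (f x)
... | no x≢y = eqF-≢ (λ fx≡fy → x≢y (f-inj fx≡fy))

↑ˡ≢↑ʳ : ∀ {a b} {v : Fin a} {j : Fin b} → v ↑ˡ b ≢ a ↑ʳ j
↑ˡ≢↑ʳ {a} {b} {v} {j} eq with ≡.trans (≡.sym (splitAt-↑ˡ a v b)) (≡.trans (≡.cong (splitAt a) eq) (splitAt-↑ʳ a b j))
... | ()

vertexIndex : ∀ {n m} → CVert n m → Fin (n ℕ.+ n ℕ.* m)
vertexIndex {n} {m} (base v)   = v ↑ˡ (n ℕ.* m)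
vertexIndex {n} {m} (copy v k) = n ↑ʳ combine v k

classify-vertexIndex : ∀ {n m} (x : CVert n m) → classify (vertexIndex x) ≡ x
classify-vertexIndex {n} {m} (base v)   rewrite splitAt-↑ˡ n v (n ℕ.* m) = ≡.refl
classify-vertexIndex {n} {m} (copy v k) rewrite splitAt-↑ʳ n (n ℕ.* m) (combine v k) =
  ≡.cong (λ (v′ , k′) → copy v′ k′) (remQuot-combine v k)

vertexIndex-classify : ∀ {n m} (i : Fin (n ℕ.+ n ℕ.* m)) → vertexIndex (classify {n} {m} i) ≡ i
vertexIndex-classify {n} {m} i with splitAt n i in eq
... | inj₁ v = splitAt⁻¹-↑ˡ eq
... | inj₂ j = ≡.trans (≡.cong (n ↑ʳ_) (combine-remQuot {n} m j)) (splitAt⁻¹-↑ʳ eq)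

vertexIndex-injective : ∀ {n m} {x y : CVert n m} → vertexIndex x ≡ vertexIndex y → x ≡ y
vertexIndex-injective {x = x} {y} eq =
  ≡.trans (≡.sym (classify-vertexIndex x)) (≡.trans (≡.cong classify eq) (classify-vertexIndex y))

base-injective : ∀ {n m} {v w : Fin n} → base {n} {m} v ≡ base w → v ≡ w
base-injective ≡.refl = ≡.refl

copy-injectiveˡ : ∀ {n m} {v w : Fin n} {k l : Fin m} → copy v k ≡ copy w l → v ≡ w
copy-injectiveˡ ≡.refl = ≡.refl

copy-injectiveʳ : ∀ {n m} {v w : Fin n} {k l : Fin m} → copy v k ≡ copy w l → k ≡ l
copy-injectiveʳ ≡.refl = ≡.refl

module Determinant {c ℓ} (S : CommutativeRing c ℓ) where
  open CommutativeRing S hiding (zero)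
  open RawDet rawRing public using (altΣ; det)
  open Algebra.Properties.Ring ring
    using (-‿distribʳ-*; -‿+-comm; -0#≈0#; -1*x≈-x; +-inverseʳ-unique; x∙y⁻¹≈ε⇒x≈y; x≈y⇒x∙y⁻¹≈ε)
  open Algebra.Solver.Ring.NaturalCoefficients.Default commutativeSemiring using (solve; _:+_; _:*_; _:=_)
  open Relation.Binary.Reasoning.Setoid setoid
  open import Algebra.Definitions.RawSemiring (CommutativeSemiring.rawSemiring commutativeSemiring) public using (_^_)

  Matrix : ℕ → Set c
  Matrix n = Fin n → Fin n → Carrier

  transpose : ∀ {n} → Matrix n → Matrix n
  transpose M i j = M j i

  minor : ∀ {n} → Matrix (suc n) → Fin (suc n) → Matrix n
  minor M j a b = M (suc a) (punchIn j b)

  x-0≈x : ∀ x → x + - 0# ≈ x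
  x-0≈x x = trans (+-congˡ -0#≈0#) (+-identityʳ x)

  altΣ-cong : ∀ n (f g : Fin n → Carrier) → (∀ i → f i ≈ g i) → altΣ n f ≈ altΣ n g
  altΣ-cong zero    f g f≈g = refl
  altΣ-cong (suc n) f g f≈g = +-cong (f≈g zero) (-‿cong (altΣ-cong n _ _ (λ i → f≈g (suc i))))

  altΣ-zero : ∀ n (f : Fin n → Carrier) → (∀ i → f i ≈ 0#) → altΣ n f ≈ 0#
  altΣ-zero zero    f f≈0 = refl
  altΣ-zero (suc n) f f≈0 =
    trans (+-cong (f≈0 zero) (-‿cong (altΣ-zero n _ (λ i → f≈0 (suc i))))) (trans (+-identityˡ _) -0#≈0#)

  altΣ-distrib-+ : ∀ n (f g : Fin n → Carrier) → altΣ n (λ i → f i + g i) ≈ altΣ n f + altΣ n g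
  altΣ-distrib-+ zero    f g = sym (+-identityʳ 0#)
  altΣ-distrib-+ (suc n) f g = begin
    (f zero + g zero) + - altΣ n (λ i → f (suc i) + g (suc i))
      ≈⟨ +-congˡ (-‿cong (altΣ-distrib-+ n (λ i → f (suc i)) (λ i → g (suc i)))) ⟩
    (f zero + g zero) + - (F + G)   ≈⟨ +-congˡ (sym (-‿+-comm F G)) ⟩
    (f zero + g zero) + (- F + - G) ≈⟨ interchange (f zero) (g zero) (- F) (- G) ⟩
    (f zero + - F) + (g zero + - G) ∎
    where
    F = altΣ n (λ i → f (suc i))
    G = altΣ n (λ i → g (suc i))
    interchange : ∀ a b c d → (a + b) + (c + d) ≈ (a + c) + (b + d)
    interchange = solve 4 (λ a b c d → (a :+ b) :+ (c :+ d) := (a :+ c) :+ (b :+ d)) refl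

  *-distribˡ-altΣ : ∀ n a (f : Fin n → Carrier) → a * altΣ n f ≈ altΣ n (λ i → a * f i)
  *-distribˡ-altΣ zero    a f = zeroʳ a
  *-distribˡ-altΣ (suc n) a f = begin
    a * (f zero + - F)       ≈⟨ distribˡ a (f zero) (- F) ⟩
    a * f zero + a * - F     ≈⟨ +-congˡ (sym (-‿distribʳ-* a F)) ⟩
    a * f zero + - (a * F)   ≈⟨ +-congˡ (-‿cong (*-distribˡ-altΣ n a (λ i → f (suc i)))) ⟩
    a * f zero + - altΣ n (λ i → a * f (suc i)) ∎
    where F = altΣ n (λ i → f (suc i))

  *-distribʳ-altΣ : ∀ n a (f : Fin n → Carrier) → altΣ n f * a ≈ altΣ n (λ i → f i * a)
  *-distribʳ-altΣ n a f = trans (*-comm _ a) (trans (*-distribˡ-altΣ n a f) (altΣ-cong n _ _ (λ i → *-comm a (f i))))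

  -‿altΣ : ∀ n (f : Fin n → Carrier) → - altΣ n f ≈ altΣ n (λ i → - f i)
  -‿altΣ n f = begin
    - altΣ n f                  ≈⟨ sym (-1*x≈-x _) ⟩
    - 1# * altΣ n f             ≈⟨ *-distribˡ-altΣ n (- 1#) f ⟩
    altΣ n (λ i → - 1# * f i)   ≈⟨ altΣ-cong n _ _ (λ i → -1*x≈-x (f i)) ⟩
    altΣ n (λ i → - f i)        ∎

  altΣ-comm : ∀ n m (f : Fin n → Fin m → Carrier) →
              altΣ n (λ i → altΣ m (f i)) ≈ altΣ m (λ j → altΣ n (λ i → f i j))
  altΣ-comm zero    m f = sym (altΣ-zero m _ (λ _ → refl))
  altΣ-comm (suc n) m f = begin
    altΣ m (f zero) + - altΣ n (λ i → altΣ m (f (suc i)))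
      ≈⟨ +-congˡ (-‿cong (altΣ-comm n m (λ i → f (suc i)))) ⟩
    altΣ m (f zero) + - altΣ m (λ j → altΣ n (λ i → f (suc i) j))
      ≈⟨ +-congˡ (-‿altΣ m _) ⟩
    altΣ m (f zero) + altΣ m (λ j → - altΣ n (λ i → f (suc i) j))
      ≈⟨ sym (altΣ-distrib-+ m _ _) ⟩
    altΣ m (λ j → f zero j + - altΣ n (λ i → f (suc i) j)) ∎

  det-cong : ∀ n (M N : Matrix n) → (∀ i j → M i j ≈ N i j) → det n M ≈ det n N
  det-cong zero    M N M≈N = refl
  det-cong (suc n) M N M≈N =
    altΣ-cong (suc n) _ _ (λ j → *-cong (M≈N zero j) (det-cong n _ _ (λ a b → M≈N (suc a) (punchIn j b))))

  columnMinor : ∀ {n} → Matrix (suc n) → Fin (suc n) → Matrix n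
  columnMinor M i a b = M (punchIn i a) (suc b)

  columnTerm : ∀ {n} → Matrix (suc n) → Fin (suc n) → Carrier
  columnTerm {n} M i = M i zero * det n (columnMinor M i)

  private
    transpose-step : ∀ {n} → (∀ M → det (suc n) (transpose M) ≈ det (suc n) M) →
                     (∀ M → det n (transpose M) ≈ det n M) →
                     ∀ M → det (suc (suc n)) (transpose M) ≈ det (suc (suc n)) M
    transpose-step {n} inv₁ inv₀ M = +-cong (*-congˡ (inv₁ (minor M zero))) (-‿cong (begin
      altΣ (suc n) (λ i → x i * det (suc n) (minor (transpose M) (suc i)))
        ≈⟨ altΣ-cong (suc n) _ (λ i → x i * altΣ (suc n) (λ j → y j * D i j))
                     (λ i → *-congˡ (inv₁ (columnMinor M (suc i)))) ⟩
      altΣ (suc n) (λ i → x i * altΣ (suc n) (λ j → y j * D i j))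
        ≈⟨ altΣ-cong (suc n) _ (λ i → altΣ (suc n) (λ j → y j * (x i * D i j)))
                     (λ i → trans (*-distribˡ-altΣ (suc n) (x i) (λ j → y j * D i j))
                                  (altΣ-cong (suc n) _ _ (λ j → x∙yz≈y∙xz (x i) (y j) (D i j)))) ⟩
      altΣ (suc n) (λ i → altΣ (suc n) (λ j → y j * (x i * D i j)))
        ≈⟨ altΣ-comm (suc n) (suc n) (λ i j → y j * (x i * D i j)) ⟩
      altΣ (suc n) (λ j → altΣ (suc n) (λ i → y j * (x i * D i j)))
        ≈⟨ altΣ-cong (suc n) _ (λ j → y j * det (suc n) (minor M (suc j)))
                     (λ j → trans (sym (*-distribˡ-altΣ (suc n) (y j) (λ i → x i * D i j)))
                                  (*-congˡ (expand-minor j))) ⟩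
      altΣ (suc n) (λ j → y j * det (suc n) (minor M (suc j))) ∎))
      where
      x y : Fin (suc n) → Carrier
      x i = M (suc i) zero
      y j = M zero (suc j)
      N : Fin (suc n) → Fin (suc n) → Matrix n
      N i j a b = M (suc (punchIn i a)) (suc (punchIn j b))
      D : Fin (suc n) → Fin (suc n) → Carrier
      D i j = det n (N i j)
      x∙yz≈y∙xz : ∀ a b d → a * (b * d) ≈ b * (a * d)
      x∙yz≈y∙xz = solve 3 (λ a b d → a :* (b :* d) := b :* (a :* d)) refl
      expand-minor : ∀ j → altΣ (suc n) (λ i → x i * D i j) ≈ det (suc n) (minor M (suc j))
      expand-minor j = begin
        altΣ (suc n) (λ i → x i * D i j)
          ≈⟨ altΣ-cong (suc n) _ (λ i → x i * det n (transpose (N i j))) (λ i → *-congˡ (sym (inv₀ (N i j)))) ⟩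
        det (suc n) (transpose (minor M (suc j))) ≈⟨ inv₁ (minor M (suc j)) ⟩
        det (suc n) (minor M (suc j))             ∎

  det-transpose : ∀ n (M : Matrix n) → det n (transpose M) ≈ det n M
  det-transpose zero          M = refl
  det-transpose (suc zero)    M = refl
  det-transpose (suc (suc n))   = transpose-step (det-transpose (suc n)) (det-transpose n)

  det-columnExpansion : ∀ n (M : Matrix (suc n)) → det (suc n) M ≈ altΣ (suc n) (columnTerm M)
  det-columnExpansion n M = trans (sym (det-transpose (suc n) M))
    (altΣ-cong (suc n) (λ i → M i zero * det n (minor (transpose M) i)) (columnTerm M)
               (λ i → *-congˡ (det-transpose n (columnMinor M i))))

  -- Multilinearity and alternation in the columns

  det-linearInColumn : ∀ n (c : Fin n) (a b : Carrier) {M₁ M₂ M : Matrix n} →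
    (∀ i j → j ≢ c → M i j ≈ M₁ i j) → (∀ i j → j ≢ c → M i j ≈ M₂ i j) →
    (∀ i → M i c ≈ a * M₁ i c + b * M₂ i c) →
    det n M ≈ a * det n M₁ + b * det n M₂
  det-linearInColumn (suc n) c a b {M₁} {M₂} {M} M≈M₁ M≈M₂ column-c = begin
    det (suc n) M
      ≈⟨ altΣ-cong (suc n) _ _ term ⟩
    altΣ (suc n) (λ j → a * f₁ j + b * f₂ j)
      ≈⟨ altΣ-distrib-+ (suc n) (λ j → a * f₁ j) (λ j → b * f₂ j) ⟩
    altΣ (suc n) (λ j → a * f₁ j) + altΣ (suc n) (λ j → b * f₂ j)
      ≈⟨ sym (+-cong (*-distribˡ-altΣ (suc n) a f₁) (*-distribˡ-altΣ (suc n) b f₂)) ⟩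
    a * det (suc n) M₁ + b * det (suc n) M₂ ∎
    where
    f₁ f₂ : Fin (suc n) → Carrier
    f₁ j = M₁ zero j * det n (minor M₁ j)
    f₂ j = M₂ zero j * det n (minor M₂ j)
    distrib-outer : ∀ a b x₁ x₂ d → (a * x₁ + b * x₂) * d ≈ a * (x₁ * d) + b * (x₂ * d)
    distrib-outer = solve 5 (λ a b x₁ x₂ d → (a :* x₁ :+ b :* x₂) :* d := a :* (x₁ :* d) :+ b :* (x₂ :* d)) refl
    distrib-inner : ∀ a b x d₁ d₂ → x * (a * d₁ + b * d₂) ≈ a * (x * d₁) + b * (x * d₂)
    distrib-inner = solve 5 (λ a b x d₁ d₂ → x :* (a :* d₁ :+ b :* d₂) := a :* (x :* d₁) :+ b :* (x :* d₂)) refl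
    term : ∀ j → M zero j * det n (minor M j) ≈ a * f₁ j + b * f₂ j
    term j with j ≟ c
    ... | yes ≡.refl = begin
      M zero c * det n (minor M c)                                              ≈⟨ *-congʳ (column-c zero) ⟩
      (a * M₁ zero c + b * M₂ zero c) * det n (minor M c)                      ≈⟨ distrib-outer a b _ _ _ ⟩
      a * (M₁ zero c * det n (minor M c)) + b * (M₂ zero c * det n (minor M c))
        ≈⟨ +-cong (*-congˡ (*-congˡ (det-cong n _ _ (λ x y → M≈M₁ (suc x) (punchIn c y) (punchInᵢ≢i c y)))))
                  (*-congˡ (*-congˡ (det-cong n _ _ (λ x y → M≈M₂ (suc x) (punchIn c y) (punchInᵢ≢i c y))))) ⟩
      a * f₁ c + b * f₂ c                                                      ∎
    ... | no j≢c = begin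
      M zero j * det n (minor M j)                                               ≈⟨ *-congˡ minor-linear ⟩
      M zero j * (a * det n (minor M₁ j) + b * det n (minor M₂ j))               ≈⟨ distrib-inner a b _ _ _ ⟩
      a * (M zero j * det n (minor M₁ j)) + b * (M zero j * det n (minor M₂ j))
        ≈⟨ +-cong (*-congˡ (*-congʳ (M≈M₁ zero j j≢c))) (*-congˡ (*-congʳ (M≈M₂ zero j j≢c))) ⟩
      a * f₁ j + b * f₂ j                                                        ∎
      where
      c′ = punchOut j≢c
      off-c′ : ∀ y → y ≢ c′ → punchIn j y ≢ c
      off-c′ y y≢c′ eq = y≢c′ (punchIn-injective j y c′ (≡.trans eq (≡.sym (punchIn-punchOut j≢c))))
      minor-linear : det n (minor M j) ≈ a * det n (minor M₁ j) + b * det n (minor M₂ j)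
      minor-linear = det-linearInColumn n c′ a b
        (λ x y y≢c′ → M≈M₁ (suc x) (punchIn j y) (off-c′ y y≢c′))
        (λ x y y≢c′ → M≈M₂ (suc x) (punchIn j y) (off-c′ y y≢c′))
        (λ x → ≡.subst (λ z → M (suc x) z ≈ a * M₁ (suc x) z + b * M₂ (suc x) z)
                       (≡.sym (punchIn-punchOut j≢c)) (column-c (suc x)))

  det-zeroColumn : ∀ n (c : Fin n) {M : Matrix n} → (∀ i → M i c ≈ 0#) → det n M ≈ 0#
  det-zeroColumn n c {M} column-c = begin
    det n M                       ≈⟨ det-linearInColumn n c 0# 0# (λ _ _ _ → refl) (λ _ _ _ → refl)
                                                        (λ i → trans (column-c i) (sym (0*x+0*y≈0 _ _))) ⟩
    0# * det n M + 0# * det n M   ≈⟨ 0*x+0*y≈0 _ _ ⟩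
    0#                            ∎
    where
    0*x+0*y≈0 : ∀ x y → 0# * x + 0# * y ≈ 0#
    0*x+0*y≈0 x y = trans (+-cong (zeroˡ x) (zeroˡ y)) (+-identityʳ 0#)

  det-additiveInColumn : ∀ n (c : Fin n) {M₁ M₂ M : Matrix n} →
    (∀ i j → j ≢ c → M i j ≈ M₁ i j) → (∀ i j → j ≢ c → M i j ≈ M₂ i j) →
    (∀ i → M i c ≈ M₁ i c + M₂ i c) →
    det n M ≈ det n M₁ + det n M₂
  det-additiveInColumn n c M≈M₁ M≈M₂ column-c =
    trans (det-linearInColumn n c 1# 1# M≈M₁ M≈M₂
                              (λ i → trans (column-c i) (sym (+-cong (*-identityˡ _) (*-identityˡ _)))))
          (+-cong (*-identityˡ _) (*-identityˡ _))

  private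
    x-[y-z]≈0 : ∀ {x y z} → x ≈ y → z ≈ 0# → x + - (y + - z) ≈ 0#
    x-[y-z]≈0 {x} {y} {z} x≈y z≈0 = begin
      x + - (y + - z) ≈⟨ +-cong x≈y (-‿cong (trans (+-congˡ (-‿cong z≈0)) (x-0≈x y))) ⟩
      y + - y         ≈⟨ -‿inverseʳ y ⟩
      0#              ∎

    leadingTerms-equal : ∀ n (M : Matrix (suc (suc n))) → (∀ i → M i zero ≈ M i (suc zero)) →
                         M zero zero * det (suc n) (minor M zero) ≈ M zero (suc zero) * det (suc n) (minor M (suc zero))
    leadingTerms-equal n M col₀≈col₁ = *-cong (col₀≈col₁ zero) (det-cong (suc n) _ _ minor₀≈minor₁)
      where
      minor₀≈minor₁ : ∀ a b → minor M zero a b ≈ minor M (suc zero) a b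
      minor₀≈minor₁ a zero    = sym (col₀≈col₁ (suc a))
      minor₀≈minor₁ a (suc b) = refl

  det-equalColumns01 : ∀ n (M : Matrix (suc (suc n))) → (∀ i → M i zero ≈ M i (suc zero)) → det (suc (suc n)) M ≈ 0#
  det-equalColumns01 zero    M col₀≈col₁ = x-[y-z]≈0 (leadingTerms-equal zero M col₀≈col₁) refl
  det-equalColumns01 (suc n) M col₀≈col₁ = x-[y-z]≈0 (leadingTerms-equal (suc n) M col₀≈col₁)
    (altΣ-zero (suc n) (λ j → M zero (suc (suc j)) * det (suc (suc n)) (minor M (suc (suc j))))
               (λ j → trans (*-congˡ (det-equalColumns01 n (minor M (suc (suc j))) (λ i → col₀≈col₁ (suc i)))) (zeroʳ _)))

  private
    swap01 : ∀ {n} → Fin (suc (suc n)) → Fin (suc (suc n))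
    swap01 zero          = suc zero
    swap01 (suc zero)    = zero
    swap01 (suc (suc j)) = suc (suc j)

    swap01-involutive : ∀ {n} (j : Fin (suc (suc n))) → swap01 (swap01 j) ≡ j
    swap01-involutive zero          = ≡.refl
    swap01-involutive (suc zero)    = ≡.refl
    swap01-involutive (suc (suc j)) = ≡.refl

    withColumns01 : ∀ {n} → (a b : Fin (suc (suc n)) → Carrier) → Matrix (suc (suc n)) → Matrix (suc (suc n))
    withColumns01 a b M i zero          = a i
    withColumns01 a b M i (suc zero)    = b i
    withColumns01 a b M i (suc (suc j)) = M i (suc (suc j))

    det-swapColumns01 : ∀ n (M : Matrix (suc (suc n))) → det (suc (suc n)) (λ i j → M i (swap01 j)) ≈ - det (suc (suc n)) M
    det-swapColumns01 n M = begin
      det n₂ (λ i j → M i (swap01 j)) ≈⟨ det-cong n₂ _ _ swapped ⟩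
      det n₂ (cols b a)               ≈⟨ +-inverseʳ-unique (det n₂ M) _ sum≈0 ⟩
      - det n₂ M                      ∎
      where
      n₂ = suc (suc n)
      cols : (Fin n₂ → Carrier) → (Fin n₂ → Carrier) → Matrix n₂
      cols x y = withColumns01 x y M
      a b a+b : Fin n₂ → Carrier
      a i = M i zero
      b i = M i (suc zero)
      a+b i = a i + b i
      swapped : ∀ i j → M i (swap01 j) ≈ cols b a i j
      swapped i zero          = refl
      swapped i (suc zero)    = refl
      swapped i (suc (suc j)) = refl
      unchanged : ∀ i j → cols a b i j ≈ M i j
      unchanged i zero          = refl
      unchanged i (suc zero)    = refl
      unchanged i (suc (suc j)) = refl
      off₀ : ∀ x₁ x₂ y i j → j ≢ zero → cols x₁ y i j ≈ cols x₂ y i j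
      off₀ x₁ x₂ y i zero          j≢0 = ⊥-elim (j≢0 ≡.refl)
      off₀ x₁ x₂ y i (suc zero)    j≢0 = refl
      off₀ x₁ x₂ y i (suc (suc j)) j≢0 = refl
      off₁ : ∀ x y₁ y₂ i j → j ≢ suc zero → cols x y₁ i j ≈ cols x y₂ i j
      off₁ x y₁ y₂ i zero          j≢1 = refl
      off₁ x y₁ y₂ i (suc zero)    j≢1 = ⊥-elim (j≢1 ≡.refl)
      off₁ x y₁ y₂ i (suc (suc j)) j≢1 = refl
      expand₁ : ∀ x → det n₂ (cols x a+b) ≈ det n₂ (cols x a) + det n₂ (cols x b)
      expand₁ x = det-additiveInColumn n₂ (suc zero) (off₁ x a+b a) (off₁ x a+b b) (λ i → refl)
      vanishing : ∀ x → det n₂ (cols x x) ≈ 0#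
      vanishing x = det-equalColumns01 n (cols x x) (λ i → refl)
      sum≈0 : det n₂ M + det n₂ (cols b a) ≈ 0#
      sum≈0 = begin
        det n₂ M + det n₂ (cols b a)
          ≈⟨ sym (+-cong (trans (+-congʳ (vanishing a)) (trans (+-identityˡ _) (det-cong n₂ _ _ unchanged)))
                         (trans (+-congˡ (vanishing b)) (+-identityʳ _))) ⟩
        (det n₂ (cols a a) + det n₂ (cols a b)) + (det n₂ (cols b a) + det n₂ (cols b b))
          ≈⟨ sym (+-cong (expand₁ a) (expand₁ b)) ⟩
        det n₂ (cols a a+b) + det n₂ (cols b a+b)
          ≈⟨ sym (det-additiveInColumn n₂ zero (off₀ a+b a a+b) (off₀ a+b b a+b) (λ i → refl)) ⟩
        det n₂ (cols a+b a+b) ≈⟨ vanishing a+b ⟩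
        0#                    ∎

    det-equalColumns0 : ∀ n (M : Matrix (suc n)) (k : Fin n) → (∀ i → M i zero ≈ M i (suc k)) → det (suc n) M ≈ 0#
    det-equalColumns0 (suc n)       M zero    col₀≈col₁ = det-equalColumns01 n M col₀≈col₁
    det-equalColumns0 (suc (suc n)) M (suc k) col₀≈colₖ = begin
      det n₃ M                        ≈⟨ det-cong n₃ _ _ (λ i j → reflexive (≡.cong (M i) (≡.sym (swap01-involutive j)))) ⟩
      det n₃ (λ i j → M′ i (swap01 j)) ≈⟨ det-swapColumns01 (suc n) M′ ⟩
      - det n₃ M′                     ≈⟨ -‿cong det-M′≈0 ⟩
      - 0#                            ≈⟨ -0#≈0# ⟩
      0#                              ∎
      where
      n₃ = suc (suc (suc n))
      M′ : Matrix n₃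
      M′ i j = M i (swap01 j)
      det-M′≈0 : det n₃ M′ ≈ 0#
      det-M′≈0 = trans (det-columnExpansion (suc (suc n)) M′) (altΣ-zero n₃ (columnTerm M′) (λ i →
        trans (*-congˡ (det-equalColumns0 (suc n) (columnMinor M′ i) k (λ a → col₀≈colₖ (punchIn i a)))) (zeroʳ _)))

  det-equalColumns : ∀ n (M : Matrix n) (j k : Fin n) → j ≢ k → (∀ i → M i j ≈ M i k) → det n M ≈ 0#
  det-equalColumns (suc n) M zero    zero    j≢k colⱼ≈colₖ = ⊥-elim (j≢k ≡.refl)
  det-equalColumns (suc n) M zero    (suc k) j≢k colⱼ≈colₖ = det-equalColumns0 n M k colⱼ≈colₖ
  det-equalColumns (suc n) M (suc j) zero    j≢k colⱼ≈colₖ = det-equalColumns0 n M j (λ i → sym (colⱼ≈colₖ i))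
  det-equalColumns (suc n) M (suc j) (suc k) j≢k colⱼ≈colₖ =
    trans (det-columnExpansion n M) (altΣ-zero (suc n) (columnTerm M) (λ i →
      trans (*-congˡ (det-equalColumns n (columnMinor M i) j k (j≢k ∘ ≡.cong suc) (λ a → colⱼ≈colₖ (punchIn i a))))
            (zeroʳ _)))

  det-equalRows : ∀ n (M : Matrix n) (j k : Fin n) → j ≢ k → (∀ i → M j i ≈ M k i) → det n M ≈ 0#
  det-equalRows n M j k j≢k rowⱼ≈rowₖ =
    trans (sym (det-transpose n M)) (det-equalColumns n (transpose M) j k j≢k rowⱼ≈rowₖ)

  augment : ∀ {m} → (Fin m → Carrier) → Matrix m → Fin m → Fin (suc m) → Carrier
  augment γ P a zero    = γ a
  augment γ P a (suc l) = P a l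

  -- Up to the sign (-1)^l, the l-th coordinate of adj(P) γ.
  cramerVector : ∀ {m} → Matrix m → (Fin m → Carrier) → Fin m → Carrier
  cramerVector {m} P γ l = det m (λ a b → augment γ P a (punchIn (suc l) b))

  cramerVector-solves : ∀ m (P : Matrix m) (γ : Fin m → Carrier) (k : Fin m) →
                        altΣ m (λ l → P k l * cramerVector P γ l) ≈ γ k * det m P
  cramerVector-solves m P γ k = sym (x∙y⁻¹≈ε⇒x≈y _ _ (det-equalRows (suc m) Q zero (suc k) (λ ()) (λ _ → refl)))
    where
    -- Rows 0 and k+1 of Q coincide; its first-row expansion is  γ k · det P − Σ± P k l · cramerVector P γ l.
    Q : Matrix (suc m)
    Q zero    = augment γ P k
    Q (suc a) = augment γ P a

  -- Block matrices

  private
    punchIn-↑ˡ : ∀ {a} b (k : Fin (suc a)) (y : Fin a) → punchIn (k ↑ˡ b) (y ↑ˡ b) ≡ punchIn k y ↑ˡ b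
    punchIn-↑ˡ b zero    y       = ≡.refl
    punchIn-↑ˡ b (suc k) zero    = ≡.refl
    punchIn-↑ˡ b (suc k) (suc y) = ≡.cong suc (punchIn-↑ˡ b k y)

    punchIn-↑ʳ : ∀ a {b} (k : Fin (suc a)) (y : Fin b) → punchIn (k ↑ˡ b) (a ↑ʳ y) ≡ suc a ↑ʳ y
    punchIn-↑ʳ a       zero    y = ≡.refl
    punchIn-↑ʳ (suc a) (suc k) y = ≡.cong suc (punchIn-↑ʳ a k y)

    altΣ-↑ˡ : ∀ a b (f : Fin (a ℕ.+ b) → Carrier) → (∀ k → f (a ↑ʳ k) ≈ 0#) →
              altΣ (a ℕ.+ b) f ≈ altΣ a (λ k → f (k ↑ˡ b))
    altΣ-↑ˡ zero    b f f≈0 = altΣ-zero b f f≈0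
    altΣ-↑ˡ (suc a) b f f≈0 = +-congˡ (-‿cong (altΣ-↑ˡ a b (λ k → f (suc k)) f≈0))

  det-blockLowerTriangular : ∀ a b (M : Matrix (a ℕ.+ b)) → (∀ i j → M (i ↑ˡ b) (a ↑ʳ j) ≈ 0#) →
    det (a ℕ.+ b) M ≈ det a (λ i j → M (i ↑ˡ b) (j ↑ˡ b)) * det b (λ i j → M (a ↑ʳ i) (a ↑ʳ j))
  det-blockLowerTriangular zero    b M _   = sym (*-identityˡ _)
  det-blockLowerTriangular (suc a) b M M↗≈0 = begin
    det (suc a ℕ.+ b) M
      ≈⟨ altΣ-↑ˡ (suc a) b (λ j → M zero j * det (a ℕ.+ b) (minor M j)) (λ k → trans (*-congʳ (M↗≈0 zero k)) (zeroˡ _)) ⟩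
    altΣ (suc a) (λ k → M zero (k ↑ˡ b) * det (a ℕ.+ b) (minor M (k ↑ˡ b)))
      ≈⟨ altΣ-cong (suc a) _ (λ k → (A zero k * det a (minor A k)) * det b B) term ⟩
    altΣ (suc a) (λ k → (A zero k * det a (minor A k)) * det b B)
      ≈⟨ sym (*-distribʳ-altΣ (suc a) (det b B) (λ k → A zero k * det a (minor A k))) ⟩
    det (suc a) A * det b B              ∎
    where
    A : Matrix (suc a)
    A i j = M (i ↑ˡ b) (j ↑ˡ b)
    B : Matrix b
    B i j = M (suc a ↑ʳ i) (suc a ↑ʳ j)
    term : ∀ k → M zero (k ↑ˡ b) * det (a ℕ.+ b) (minor M (k ↑ˡ b)) ≈ (A zero k * det a (minor A k)) * det b B
    term k = begin
      M zero (k ↑ˡ b) * det (a ℕ.+ b) (minor M (k ↑ˡ b))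
        ≈⟨ *-congˡ (det-blockLowerTriangular a b (minor M (k ↑ˡ b))
                      (λ i j → trans (reflexive (≡.cong (M (suc (i ↑ˡ b))) (punchIn-↑ʳ a k j))) (M↗≈0 (suc i) j))) ⟩
      A zero k * (det a (λ i j → minor M (k ↑ˡ b) (i ↑ˡ b) (j ↑ˡ b)) *
                  det b (λ i j → minor M (k ↑ˡ b) (a ↑ʳ i) (a ↑ʳ j)))
        ≈⟨ *-congˡ (*-cong (det-cong a _ _ (λ i j → reflexive (≡.cong (M (suc (i ↑ˡ b))) (punchIn-↑ˡ b k j))))
                           (det-cong b _ _ (λ i j → reflexive (≡.cong (M (suc (a ↑ʳ i))) (punchIn-↑ʳ a k j))))) ⟩
      A zero k * (det a (minor A k) * det b B) ≈⟨ sym (*-assoc _ _ _) ⟩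
      (A zero k * det a (minor A k)) * det b B ∎

  det-blockUpperTriangular : ∀ a b (M : Matrix (a ℕ.+ b)) → (∀ i j → M (a ↑ʳ i) (j ↑ˡ b) ≈ 0#) →
    det (a ℕ.+ b) M ≈ det a (λ i j → M (i ↑ˡ b) (j ↑ˡ b)) * det b (λ i j → M (a ↑ʳ i) (a ↑ʳ j))
  det-blockUpperTriangular a b M M↙≈0 = begin
    det (a ℕ.+ b) M           ≈⟨ sym (det-transpose (a ℕ.+ b) M) ⟩
    det (a ℕ.+ b) (transpose M) ≈⟨ det-blockLowerTriangular a b (transpose M) (λ i j → M↙≈0 j i) ⟩
    det a (λ i j → M (j ↑ˡ b) (i ↑ˡ b)) * det b (λ i j → M (a ↑ʳ j) (a ↑ʳ i))
      ≈⟨ *-cong (det-transpose a (λ i j → M (i ↑ˡ b) (j ↑ˡ b))) (det-transpose b (λ i j → M (a ↑ʳ i) (a ↑ʳ j))) ⟩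
    det a (λ i j → M (i ↑ˡ b) (j ↑ˡ b)) * det b (λ i j → M (a ↑ʳ i) (a ↑ʳ j)) ∎

  det-blockDiagonal : ∀ n m (K : Matrix (n ℕ.* m)) (P : Matrix m) →
    (∀ (v : Fin n) (k l : Fin m) → K (combine v k) (combine v l) ≈ P k l) →
    (∀ (v w : Fin n) (k l : Fin m) → v ≢ w → K (combine v k) (combine w l) ≈ 0#) →
    det (n ℕ.* m) K ≈ det m P ^ n
  det-blockDiagonal zero    m K P diagonal offDiagonal = refl
  det-blockDiagonal (suc n) m K P diagonal offDiagonal = begin
    det (m ℕ.+ n ℕ.* m) K
      ≈⟨ det-blockLowerTriangular m (n ℕ.* m) K first-row-of-blocks ⟩
    det m (λ k l → K (k ↑ˡ (n ℕ.* m)) (l ↑ˡ (n ℕ.* m))) * det (n ℕ.* m) (λ i j → K (m ↑ʳ i) (m ↑ʳ j))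
      ≈⟨ *-cong (det-cong m _ P (diagonal zero))
                (det-blockDiagonal n m _ P (λ v k l → diagonal (suc v) k l)
                                           (λ v w k l v≢w → offDiagonal (suc v) (suc w) k l (v≢w ∘ suc-injective))) ⟩
    det m P * det m P ^ n ∎
    where
    first-row-of-blocks : ∀ k j → K (k ↑ˡ (n ℕ.* m)) (m ↑ʳ j) ≈ 0#
    first-row-of-blocks k j with (w , l , ≡.refl) ← combine-surjective {n} {m} j = offDiagonal zero (suc w) k l (λ ())

  -- Column operations

  replaceColumn : ∀ {n} → Matrix n → Fin n → (Fin n → Carrier) → Matrix n
  replaceColumn M c x i j with j ≟ c
  ... | yes _ = x i
  ... | no  _ = M i j

  replaceColumn-at : ∀ {n} (M : Matrix n) c x i → replaceColumn M c x i c ≈ x i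
  replaceColumn-at M c x i with c ≟ c
  ... | yes _   = refl
  ... | no  c≢c = ⊥-elim (c≢c ≡.refl)

  replaceColumn-off : ∀ {n} (M : Matrix n) c x i j → j ≢ c → replaceColumn M c x i j ≈ M i j
  replaceColumn-off M c x i j j≢c with j ≟ c
  ... | yes j≡c = ⊥-elim (j≢c j≡c)
  ... | no  _   = refl

  det-dependentColumn : ∀ n m (c : Fin n) (d : Fin m → Fin n) (w : Fin m → Carrier) {M Y : Matrix n} →
    (∀ l → d l ≢ c) → (∀ i j → j ≢ c → Y i j ≈ M i j) →
    (∀ i → Y i c ≈ altΣ m (λ l → w l * M i (d l))) → det n Y ≈ 0#
  det-dependentColumn n zero    c d w         d≢c Y≈M column-c = det-zeroColumn n c column-c
  det-dependentColumn n (suc m) c d w {M} {Y} d≢c Y≈M column-c = begin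
    det n Y                          ≈⟨ det-linearInColumn n c (w zero) (- 1#) off-c off-c column-c-split ⟩
    w zero * det n Y₀ + - 1# * det n Y₊ ≈⟨ +-cong (*-congˡ det-Y₀≈0) (*-congˡ det-Y₊≈0) ⟩
    w zero * 0# + - 1# * 0#          ≈⟨ trans (+-cong (zeroʳ _) (zeroʳ _)) (+-identityʳ 0#) ⟩
    0#                               ∎
    where
    rest : Fin n → Carrier
    rest i = altΣ m (λ l → w (suc l) * M i (d (suc l)))
    Y₀ Y₊ : Matrix n
    Y₀ = replaceColumn M c (λ i → M i (d zero))
    Y₊ = replaceColumn M c rest
    off-c : ∀ {x} i j → j ≢ c → Y i j ≈ replaceColumn M c x i j
    off-c i j j≢c = trans (Y≈M i j j≢c) (sym (replaceColumn-off M c _ i j j≢c))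
    column-c-split : ∀ i → Y i c ≈ w zero * Y₀ i c + - 1# * Y₊ i c
    column-c-split i = trans (column-c i) (+-cong (*-congˡ (sym (replaceColumn-at M c _ i)))
                                                  (trans (sym (-1*x≈-x _)) (*-congˡ (sym (replaceColumn-at M c _ i)))))
    det-Y₀≈0 : det n Y₀ ≈ 0#
    det-Y₀≈0 = det-equalColumns n Y₀ c (d zero) (λ c≡d → d≢c zero (≡.sym c≡d))
                 (λ i → trans (replaceColumn-at M c _ i) (sym (replaceColumn-off M c _ i (d zero) (d≢c zero))))
    det-Y₊≈0 : det n Y₊ ≈ 0#
    det-Y₊≈0 = det-dependentColumn n m c (λ l → d (suc l)) (λ l → w (suc l)) (λ l → d≢c (suc l))
                 (λ i j j≢c → replaceColumn-off M c _ i j j≢c) (λ i → replaceColumn-at M c _ i)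

  det-columnOperation : ∀ n m (c : Fin n) (d : Fin m → Fin n) (w : Fin m → Carrier) (p : Carrier) {M M′ : Matrix n} →
    (∀ l → d l ≢ c) → (∀ i j → j ≢ c → M′ i j ≈ M i j) →
    (∀ i → M′ i c ≈ p * M i c + - altΣ m (λ l → w l * M i (d l))) →
    det n M′ ≈ p * det n M
  det-columnOperation n m c d w p {M} {M′} d≢c M′≈M column-c = begin
    det n M′                         ≈⟨ det-linearInColumn n c p (- 1#) M′≈M off-c column-c-split ⟩
    p * det n M + - 1# * det n Y     ≈⟨ +-congˡ (*-congˡ det-Y≈0) ⟩
    p * det n M + - 1# * 0#          ≈⟨ trans (+-congˡ (zeroʳ _)) (+-identityʳ _) ⟩
    p * det n M                      ∎
    where
    Y : Matrix n
    Y = replaceColumn M c (λ i → altΣ m (λ l → w l * M i (d l)))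
    off-c : ∀ i j → j ≢ c → M′ i j ≈ Y i j
    off-c i j j≢c = trans (M′≈M i j j≢c) (sym (replaceColumn-off M c _ i j j≢c))
    column-c-split : ∀ i → M′ i c ≈ p * M i c + - 1# * Y i c
    column-c-split i = trans (column-c i) (+-congˡ (trans (sym (-1*x≈-x _)) (*-congˡ (sym (replaceColumn-at M c _ i)))))
    det-Y≈0 : det n Y ≈ 0#
    det-Y≈0 = det-dependentColumn n m c d w d≢c (λ i j j≢c → replaceColumn-off M c _ i j j≢c)
                                               (λ i → replaceColumn-at M c _ i)

  private
    <ᵇ-suc : ∀ x t → x ≢ t → (x <ᵇ suc t) ≡ (x <ᵇ t)
    <ᵇ-suc zero    zero    x≢t = ⊥-elim (x≢t ≡.refl)
    <ᵇ-suc zero    (suc t) _   = ≡.refl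
    <ᵇ-suc (suc x) zero    _   = ≡.refl
    <ᵇ-suc (suc x) (suc t) x≢t = <ᵇ-suc x t (x≢t ∘ ≡.cong suc)

    n<ᵇ1+n : ∀ t → (t <ᵇ suc t) ≡ true
    n<ᵇ1+n zero    = ≡.refl
    n<ᵇ1+n (suc t) = n<ᵇ1+n t

    n<ᵇn : ∀ t → (t <ᵇ t) ≡ false
    n<ᵇn zero    = ≡.refl
    n<ᵇn (suc t) = n<ᵇn t

    toℕ<ᵇn : ∀ {n} (v : Fin n) → (toℕ v <ᵇ n) ≡ true
    toℕ<ᵇn zero    = ≡.refl
    toℕ<ᵇn (suc v) = toℕ<ᵇn v

  det-eliminateColumns : ∀ n K m (p : Carrier) (d : Fin n → Fin m → Fin K) (w : Fin n → Fin m → Carrier)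
                         (M M′ : Matrix (n ℕ.+ K)) →
    (∀ i k → M′ i (n ↑ʳ k) ≈ M i (n ↑ʳ k)) →
    (∀ i v → M′ i (v ↑ˡ K) ≈ p * M i (v ↑ˡ K) + - altΣ m (λ l → w v l * M i (n ↑ʳ d v l))) →
    det (n ℕ.+ K) M′ ≈ p ^ n * det (n ℕ.+ K) M
  det-eliminateColumns n K m p d w M M′ M′≈M eliminated = begin
    det (n ℕ.+ K) M′          ≈⟨ det-cong (n ℕ.+ K) _ _ (λ i j → sym (afterSteps-n i j)) ⟩
    det (n ℕ.+ K) (afterSteps n) ≈⟨ det-afterSteps n ℕ.≤-refl ⟩
    p ^ n * det (n ℕ.+ K) M   ∎
    where
    afterSteps : ℕ → Matrix (n ℕ.+ K)
    afterSteps t i j =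
      [ (λ v → if toℕ v <ᵇ t then M′ i (v ↑ˡ K) else M i (v ↑ˡ K)) , (λ k → M i (n ↑ʳ k)) ]′ (splitAt n j)

    afterSteps-eliminated : ∀ t i v → (toℕ v <ᵇ t) ≡ true → afterSteps t i (v ↑ˡ K) ≈ M′ i (v ↑ˡ K)
    afterSteps-eliminated t i v v<t rewrite splitAt-↑ˡ n v K | v<t = refl

    afterSteps-original : ∀ t i v → (toℕ v <ᵇ t) ≡ false → afterSteps t i (v ↑ˡ K) ≈ M i (v ↑ˡ K)
    afterSteps-original t i v v≮t rewrite splitAt-↑ˡ n v K | v≮t = refl

    afterSteps-↑ʳ : ∀ t i k → afterSteps t i (n ↑ʳ k) ≡ M i (n ↑ʳ k)
    afterSteps-↑ʳ t i k rewrite splitAt-↑ʳ n K k = ≡.refl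

    afterSteps-0 : ∀ i j → afterSteps zero i j ≈ M i j
    afterSteps-0 i j = reflexive (≡.trans (≡.sym (∘-join-splitAt j)) (≡.cong (M i) (join-splitAt n K j)))
      where
      ∘-join-splitAt : ∀ j → M i (Fin.join n K (splitAt n j)) ≡ afterSteps zero i j
      ∘-join-splitAt j with splitAt n j
      ... | inj₁ v = ≡.refl
      ... | inj₂ k = ≡.refl

    afterSteps-n : ∀ i j → afterSteps n i j ≈ M′ i j
    afterSteps-n i j with splitAt n j in eq
    ... | inj₁ v rewrite toℕ<ᵇn v = reflexive (≡.cong (M′ i) (splitAt⁻¹-↑ˡ eq))
    ... | inj₂ k = sym (trans (reflexive (≡.cong (M′ i) (≡.sym (splitAt⁻¹-↑ʳ eq)))) (M′≈M i k))

    afterSteps-suc : ∀ t (t<n : t ℕ.< n) → det (n ℕ.+ K) (afterSteps (suc t)) ≈ p * det (n ℕ.+ K) (afterSteps t)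
    afterSteps-suc t t<n = det-columnOperation (n ℕ.+ K) m (v₀ ↑ˡ K) (λ l → n ↑ʳ d v₀ l) (w v₀) p
      (λ l eq → ↑ˡ≢↑ʳ (≡.sym eq)) off-column at-column
      where
      v₀ = Fin.fromℕ< t<n
      toℕ-v₀ : toℕ v₀ ≡ t
      toℕ-v₀ = toℕ-fromℕ< t<n
      toℕ≢t : ∀ {v} → v ≢ v₀ → toℕ v ≢ t
      toℕ≢t v≢v₀ v≡t = v≢v₀ (toℕ-injective (≡.trans v≡t (≡.sym toℕ-v₀)))
      off-column : ∀ i j → j ≢ v₀ ↑ˡ K → afterSteps (suc t) i j ≈ afterSteps t i j
      off-column i j j≢c with splitAt n j in eq
      ... | inj₂ k = refl
      ... | inj₁ v
        rewrite <ᵇ-suc (toℕ v) t (toℕ≢t (λ v≡v₀ → j≢c (≡.trans (≡.sym (splitAt⁻¹-↑ˡ eq)) (≡.cong (_↑ˡ K) v≡v₀))))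
        = refl
      at-column : ∀ i → afterSteps (suc t) i (v₀ ↑ˡ K) ≈
                        p * afterSteps t i (v₀ ↑ˡ K) + - altΣ m (λ l → w v₀ l * afterSteps t i (n ↑ʳ d v₀ l))
      at-column i = begin
        afterSteps (suc t) i (v₀ ↑ˡ K) ≈⟨ afterSteps-eliminated (suc t) i v₀ (≡.trans (≡.cong (_<ᵇ suc t) toℕ-v₀) (n<ᵇ1+n t)) ⟩
        M′ i (v₀ ↑ˡ K)              ≈⟨ eliminated i v₀ ⟩
        p * M i (v₀ ↑ˡ K) + - altΣ m (λ l → w v₀ l * M i (n ↑ʳ d v₀ l))
          ≈⟨ sym (+-cong (*-congˡ (afterSteps-original t i v₀ (≡.trans (≡.cong (_<ᵇ t) toℕ-v₀) (n<ᵇn t))))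
                         (-‿cong (altΣ-cong m _ _ (λ l → *-congˡ (reflexive (afterSteps-↑ʳ t i (d v₀ l))))))) ⟩
        p * afterSteps t i (v₀ ↑ˡ K) + - altΣ m (λ l → w v₀ l * afterSteps t i (n ↑ʳ d v₀ l)) ∎

    det-afterSteps : ∀ t → t ℕ.≤ n → det (n ℕ.+ K) (afterSteps t) ≈ p ^ t * det (n ℕ.+ K) M
    det-afterSteps zero    _     = trans (det-cong (n ℕ.+ K) _ _ afterSteps-0) (sym (*-identityˡ _))
    det-afterSteps (suc t) 1+t≤n = begin
      det (n ℕ.+ K) (afterSteps (suc t))   ≈⟨ afterSteps-suc t 1+t≤n ⟩
      p * det (n ℕ.+ K) (afterSteps t)     ≈⟨ *-congˡ (det-afterSteps t (ℕ.<⇒≤ 1+t≤n)) ⟩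
      p * (p ^ t * det (n ℕ.+ K) M)     ≈⟨ sym (*-assoc _ _ _) ⟩
      p ^ suc t * det (n ℕ.+ K) M       ∎

  -- Block elimination in the shape of a coalescence

  blockEntry : ∀ {n m} → Matrix n → (β γ : Fin m → Carrier) → Matrix m → CVert n m → CVert n m → Carrier
  blockEntry A β γ P (base v)   (base w)   = A v w
  blockEntry A β γ P (base v)   (copy w l) = if eqF v w then β l else 0#
  blockEntry A β γ P (copy v k) (base w)   = if eqF v w then γ k else 0#
  blockEntry A β γ P (copy v k) (copy w l) = if eqF v w then P k l else 0#

  blockMatrix : ∀ {n m} → Matrix n → (β γ : Fin m → Carrier) → Matrix m → Matrix (n ℕ.+ n ℕ.* m)
  blockMatrix A β γ P i j = blockEntry A β γ P (classify i) (classify j)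

  blockMatrix-vertexIndex : ∀ {n m} (A : Matrix n) (β γ : Fin m → Carrier) (P : Matrix m) x y →
                            blockMatrix A β γ P (vertexIndex x) (vertexIndex y) ≈ blockEntry A β γ P x y
  blockMatrix-vertexIndex A β γ P x y rewrite classify-vertexIndex x | classify-vertexIndex y = refl

  -- p · (A − B P⁻¹ C) for p = det P, where B P⁻¹ C is the scalar matrix (βᵀ P⁻¹ γ) I.
  scaledSchurComplement : ∀ {n m} → Matrix n → (β γ : Fin m → Carrier) → Matrix m → Matrix n
  scaledSchurComplement {n} {m} A β γ P v w =
    det m P * A v w + - (if eqF v w then altΣ m (λ l → cramerVector P γ l * β l) else 0#)

  det-blockMatrix : ∀ n m (A : Matrix n) (β γ : Fin m → Carrier) (P : Matrix m) →
    det m P ^ n * det (n ℕ.+ n ℕ.* m) (blockMatrix A β γ P) ≈ det n (scaledSchurComplement A β γ P) * det m P ^ n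
  det-blockMatrix n m A β γ P = begin
    p ^ n * det (n ℕ.+ nm) M
      ≈⟨ sym (det-eliminateColumns n nm m p combine (λ _ → D) M M′
                (λ i k → reflexive (M′-↑ʳ i k)) (λ i v → reflexive (M′-↑ˡ i v))) ⟩
    det (n ℕ.+ nm) M′
      ≈⟨ det-blockUpperTriangular n nm M′ lowerLeft≈0 ⟩
    det n (λ v w → M′ (v ↑ˡ nm) (w ↑ˡ nm)) * det nm (λ i j → M′ (n ↑ʳ i) (n ↑ʳ j))
      ≈⟨ *-cong (det-cong n _ _ upperLeft) (trans (det-cong nm _ _ (λ i j → reflexive (M′-↑ʳ (n ↑ʳ i) j)))
                                                 (det-blockDiagonal n m _ P diagonalBlock offDiagonalBlock)) ⟩
    det n (scaledSchurComplement A β γ P) * p ^ n ∎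
    where
    nm = n ℕ.* m
    p = det m P
    D = cramerVector P γ
    M M′ : Matrix (n ℕ.+ nm)
    M = blockMatrix A β γ P
    M′ i j = [ (λ v → p * M i (v ↑ˡ nm) + - altΣ m (λ l → D l * M i (n ↑ʳ combine v l))) , (λ k → M i (n ↑ʳ k)) ]′
               (splitAt n j)

    M′-↑ˡ : ∀ i v → M′ i (v ↑ˡ nm) ≡ p * M i (v ↑ˡ nm) + - altΣ m (λ l → D l * M i (n ↑ʳ combine v l))
    M′-↑ˡ i v = ≡.cong [ _ , _ ]′ (splitAt-↑ˡ n v nm)
    M′-↑ʳ : ∀ i k → M′ i (n ↑ʳ k) ≡ M i (n ↑ʳ k)
    M′-↑ʳ i k = ≡.cong [ _ , _ ]′ (splitAt-↑ʳ n nm k)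

    entry : ∀ x y → M (vertexIndex x) (vertexIndex y) ≈ blockEntry A β γ P x y
    entry = blockMatrix-vertexIndex A β γ P

    altΣ-D*0 : altΣ m (λ l → D l * 0#) ≈ 0#
    altΣ-D*0 = altΣ-zero m _ (λ l → zeroʳ (D l))

    lowerLeft≈0 : ∀ i w → M′ (n ↑ʳ i) (w ↑ˡ nm) ≈ 0#
    lowerLeft≈0 i w with (v , k , ≡.refl) ← combine-surjective {n} {m} i = begin
      M′ (n ↑ʳ combine v k) (w ↑ˡ nm)
        ≈⟨ trans (reflexive (M′-↑ˡ _ w)) (+-cong (*-congˡ (entry (copy v k) (base w)))
                                                  (-‿cong (altΣ-cong m _ _ (λ l → *-congˡ (entry (copy v k) (copy w l)))))) ⟩
      p * (if eqF v w then γ k else 0#) + - altΣ m (λ l → D l * (if eqF v w then P k l else 0#))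
        ≈⟨ vanishes (eqF v w) ⟩
      0# ∎
      where
      vanishes : ∀ b → p * (if b then γ k else 0#) + - altΣ m (λ l → D l * (if b then P k l else 0#)) ≈ 0#
      vanishes true  = x≈y⇒x∙y⁻¹≈ε (sym (trans (altΣ-cong m _ _ (λ l → *-comm (D l) (P k l)))
                                            (trans (cramerVector-solves m P γ k) (*-comm (γ k) p))))
      vanishes false = trans (+-cong (zeroʳ p) (-‿cong altΣ-D*0)) (trans (+-identityˡ _) -0#≈0#)

    upperLeft : ∀ v w → M′ (v ↑ˡ nm) (w ↑ˡ nm) ≈ scaledSchurComplement A β γ P v w
    upperLeft v w = trans (reflexive (M′-↑ˡ _ w))
      (+-cong (*-congˡ (entry (base v) (base w)))
              (-‿cong (trans (altΣ-cong m _ _ (λ l → *-congˡ (entry (base v) (copy w l)))) (correction (eqF v w)))))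
      where
      correction : ∀ b → altΣ m (λ l → D l * (if b then β l else 0#)) ≈ (if b then altΣ m (λ l → D l * β l) else 0#)
      correction true  = refl
      correction false = altΣ-D*0

    diagonalBlock : ∀ v k l → M (n ↑ʳ combine v k) (n ↑ʳ combine v l) ≈ P k l
    diagonalBlock v k l = trans (entry (copy v k) (copy v l)) (reflexive (≡.cong (if_then P k l else 0#) (eqF-refl v)))

    offDiagonalBlock : ∀ v w k l → v ≢ w → M (n ↑ʳ combine v k) (n ↑ʳ combine w l) ≈ 0#
    offDiagonalBlock v w k l v≢w = trans (entry (copy v k) (copy w l)) (reflexive (≡.cong (if_then P k l else 0#) (eqF-≢ v≢w)))

module PowerSeries {c ℓ} (R : CommutativeRing c ℓ) where
  open CommutativeRing R hiding (zero)
  open Algebra.Solver.Ring.NaturalCoefficients.Default commutativeSemiring using (solve; _:+_; _:*_; _:=_)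
  open Relation.Binary.Reasoning.Setoid setoid

  infix 4 _≋_
  _≋_ : Series R → Series R → Set ℓ
  f ≋ g = ∀ k → f k ≈ g k

  shift : Series R → Series R
  shift f k = f (suc k)

  private
    conv-zero : ∀ f g → conv R f g 0 ≈ f 0 * g 0
    conv-zero f g = +-identityʳ _

  conv-cong : ∀ {f f′ g g′} → f ≋ f′ → g ≋ g′ → conv R f g ≋ conv R f′ g′
  conv-cong f≋f′ g≋g′ zero    = +-congʳ (*-cong (f≋f′ 0) (g≋g′ 0))
  conv-cong f≋f′ g≋g′ (suc k) = +-cong (*-cong (f≋f′ 0) (g≋g′ (suc k))) (conv-cong (λ j → f≋f′ (suc j)) g≋g′ k)

  conv-zeroˡ : ∀ f g → f ≋ (λ _ → 0#) → conv R f g ≋ (λ _ → 0#)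
  conv-zeroˡ f g f≋0 zero    = trans (conv-zero f g) (trans (*-congʳ (f≋0 0)) (zeroˡ _))
  conv-zeroˡ f g f≋0 (suc k) =
    trans (+-cong (trans (*-congʳ (f≋0 0)) (zeroˡ _)) (conv-zeroˡ (shift f) g (λ j → f≋0 (suc j)) k)) (+-identityʳ 0#)

  conv-sucʳ : ∀ f g k → conv R f g (suc k) ≈ conv R f (shift g) k + f (suc k) * g 0
  conv-sucʳ f g zero    = begin
    f 0 * g 1 + (f 1 * g 0 + 0#) ≈⟨ +-congˡ (+-identityʳ _) ⟩
    f 0 * g 1 + f 1 * g 0        ≈⟨ +-congʳ (sym (+-identityʳ _)) ⟩
    (f 0 * g 1 + 0#) + f 1 * g 0 ∎
  conv-sucʳ f g (suc k) = begin
    f 0 * g (2 ℕ.+ k) + conv R (shift f) g (suc k)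
      ≈⟨ +-congˡ (conv-sucʳ (shift f) g k) ⟩
    f 0 * g (2 ℕ.+ k) + (conv R (shift f) (shift g) k + f (2 ℕ.+ k) * g 0)
      ≈⟨ sym (+-assoc _ _ _) ⟩
    (f 0 * g (2 ℕ.+ k) + conv R (shift f) (shift g) k) + f (2 ℕ.+ k) * g 0 ∎

  conv-comm : ∀ f g → conv R f g ≋ conv R g f
  conv-comm f g zero    = +-congʳ (*-comm _ _)
  conv-comm f g (suc k) = begin
    f 0 * g (suc k) + conv R (shift f) g k ≈⟨ +-cong (*-comm _ _) (conv-comm (shift f) g k) ⟩
    g (suc k) * f 0 + conv R g (shift f) k ≈⟨ +-comm _ _ ⟩
    conv R g (shift f) k + g (suc k) * f 0 ≈⟨ sym (conv-sucʳ g f k) ⟩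
    conv R g f (suc k)                     ∎

  conv-distribʳ : ∀ f f′ g → conv R (λ j → f j + f′ j) g ≋ (λ k → conv R f g k + conv R f′ g k)
  conv-distribʳ f f′ g zero = begin
    (f 0 + f′ 0) * g 0 + 0#                  ≈⟨ +-identityʳ _ ⟩
    (f 0 + f′ 0) * g 0                       ≈⟨ distribʳ _ _ _ ⟩
    f 0 * g 0 + f′ 0 * g 0                   ≈⟨ sym (+-cong (+-identityʳ _) (+-identityʳ _)) ⟩
    (f 0 * g 0 + 0#) + (f′ 0 * g 0 + 0#)     ∎
  conv-distribʳ f f′ g (suc k) = begin
    (f 0 + f′ 0) * g (suc k) + conv R (λ j → f (suc j) + f′ (suc j)) g k
      ≈⟨ +-cong (distribʳ _ _ _) (conv-distribʳ (shift f) (shift f′) g k) ⟩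
    (f 0 * g (suc k) + f′ 0 * g (suc k)) + (conv R (shift f) g k + conv R (shift f′) g k)
      ≈⟨ interchange _ _ _ _ ⟩
    (f 0 * g (suc k) + conv R (shift f) g k) + (f′ 0 * g (suc k) + conv R (shift f′) g k) ∎
    where
    interchange : ∀ a b c d → (a + b) + (c + d) ≈ (a + c) + (b + d)
    interchange = solve 4 (λ a b c d → (a :+ b) :+ (c :+ d) := (a :+ c) :+ (b :+ d)) refl

  conv-scalarˡ : ∀ a f g → conv R (λ j → a * f j) g ≋ (λ k → a * conv R f g k)
  conv-scalarˡ a f g zero    = trans (+-identityʳ _) (trans (*-assoc _ _ _) (*-congˡ (sym (+-identityʳ _))))
  conv-scalarˡ a f g (suc k) = trans (+-cong (*-assoc _ _ _) (conv-scalarˡ a (shift f) g k)) (sym (distribˡ a _ _))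

  conv-assoc : ∀ f g h → conv R (conv R f g) h ≋ conv R f (conv R g h)
  conv-assoc f g h zero = begin
    (f 0 * g 0 + 0#) * h 0 + 0# ≈⟨ +-congʳ (*-congʳ (+-identityʳ _)) ⟩
    (f 0 * g 0) * h 0 + 0#      ≈⟨ +-congʳ (*-assoc _ _ _) ⟩
    f 0 * (g 0 * h 0) + 0#      ≈⟨ +-congʳ (*-congˡ (sym (+-identityʳ _))) ⟩
    f 0 * (g 0 * h 0 + 0#) + 0# ∎
  conv-assoc f g h (suc k) = begin
    conv R f g 0 * h (suc k) + conv R (λ j → f 0 * g (suc j) + conv R (shift f) g j) h k
      ≈⟨ +-cong (*-congʳ (conv-zero f g)) (conv-distribʳ (λ j → f 0 * g (suc j)) (conv R (shift f) g) h k) ⟩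
    (f 0 * g 0) * h (suc k) + (conv R (λ j → f 0 * g (suc j)) h k + conv R (conv R (shift f) g) h k)
      ≈⟨ +-congˡ (+-cong (conv-scalarˡ (f 0) (shift g) h k) (conv-assoc (shift f) g h k)) ⟩
    (f 0 * g 0) * h (suc k) + (f 0 * conv R (shift g) h k + conv R (shift f) (conv R g h) k)
      ≈⟨ factor _ _ _ _ _ ⟩
    f 0 * (g 0 * h (suc k) + conv R (shift g) h k) + conv R (shift f) (conv R g h) k ∎
    where
    factor : ∀ a b c d e → (a * b) * c + (a * d + e) ≈ a * (b * c + d) + e
    factor = solve 5 (λ a b c d e → (a :* b) :* c :+ (a :* d :+ e) := a :* (b :* c :+ d) :+ e) refl

  1ₛ : Series R
  1ₛ = RawRing.1# (SeriesRing R)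

  conv-identityˡ : ∀ f → conv R 1ₛ f ≋ f
  conv-identityˡ f zero    = trans (+-identityʳ _) (*-identityˡ _)
  conv-identityˡ f (suc k) = trans (+-cong (*-identityˡ _) (conv-zeroˡ _ f (λ _ → refl) k)) (+-identityʳ _)

  -- Kept opaque: a transparent  conv R f g k  unfolds during unification, so the implicit
  -- arguments of the ring lemmas could no longer be inferred for series.  charPoly, which
  -- multiplies with conv itself, is related to det over seriesRing by det-SeriesRing.
  opaque
    infixl 7 _*ₛ_
    _*ₛ_ : Series R → Series R → Series R
    _*ₛ_ = conv R

    *ₛ-conv : ∀ f g → f *ₛ g ≋ conv R f g
    *ₛ-conv f g k = refl

  private
    from-conv : ∀ {f g f′ g′} → conv R f g ≋ conv R f′ g′ → f *ₛ g ≋ f′ *ₛ g′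
    from-conv {f} {g} {f′} {g′} eq k = trans (*ₛ-conv f g k) (trans (eq k) (sym (*ₛ-conv f′ g′ k)))

    *ₛ-assoc : ∀ f g h → (f *ₛ g) *ₛ h ≋ f *ₛ (g *ₛ h)
    *ₛ-assoc f g h = from-conv (λ k →
      trans (conv-cong {g = h} {g′ = h} (*ₛ-conv f g) (λ _ → refl) k)
            (trans (conv-assoc f g h k) (conv-cong {f = f} {f′ = f} (λ _ → refl) (λ j → sym (*ₛ-conv g h j)) k)))

    *ₛ-identityˡ : ∀ f → 1ₛ *ₛ f ≋ f
    *ₛ-identityˡ f k = trans (*ₛ-conv 1ₛ f k) (conv-identityˡ f k)

    *ₛ-distribʳ : ∀ h f g → (λ k → f k + g k) *ₛ h ≋ (λ k → (f *ₛ h) k + (g *ₛ h) k)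
    *ₛ-distribʳ h f g k = trans (*ₛ-conv _ h k) (trans (conv-distribʳ f g h k) (sym (+-cong (*ₛ-conv f h k) (*ₛ-conv g h k))))

  seriesRing : CommutativeRing c ℓ
  seriesRing = record
    { Carrier = Series R
    ; _≈_ = _≋_
    ; _+_ = λ f g k → f k + g k
    ; _*_ = _*ₛ_
    ; -_ = λ f k → - f k
    ; 0# = λ _ → 0#
    ; 1# = 1ₛ
    ; isCommutativeRing = record
      { isRing = record
        { +-isAbelianGroup = record
          { isGroup = record
            { isMonoid = record
              { isSemigroup = record
                { isMagma = record
                  { isEquivalence = record
                    { refl = λ k → refl ; sym = λ f≋g k → sym (f≋g k) ; trans = λ f≋g g≋h k → trans (f≋g k) (g≋h k) }
                  ; ∙-cong = λ f≋f′ g≋g′ k → +-cong (f≋f′ k) (g≋g′ k) }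
                ; assoc = λ f g h k → +-assoc (f k) (g k) (h k) }
              ; identity = (λ f k → +-identityˡ (f k)) , (λ f k → +-identityʳ (f k)) }
            ; inverse = (λ f k → -‿inverseˡ (f k)) , (λ f k → -‿inverseʳ (f k))
            ; ⁻¹-cong = λ f≋g k → -‿cong (f≋g k) }
          ; comm = λ f g k → +-comm (f k) (g k) }
        ; *-cong = λ f≋f′ g≋g′ → from-conv (conv-cong f≋f′ g≋g′)
        ; *-assoc = *ₛ-assoc
        ; *-identity = *ₛ-identityˡ , (λ f → from-conv (conv-comm f 1ₛ) ◇ *ₛ-identityˡ f)
        ; distrib = (λ h f g → from-conv (conv-comm h _) ◇
                                (*ₛ-distribʳ h f g ◇ (λ k → +-cong (from-conv (conv-comm f h) k) (from-conv (conv-comm g h) k))))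
                  , *ₛ-distribʳ }
      ; *-comm = λ f g → from-conv (conv-comm f g) } }
    where
    _◇_ : ∀ {f g h} → f ≋ g → g ≋ h → f ≋ h
    (f≋g ◇ g≋h) k = trans (f≋g k) (g≋h k)

module Polynomials {c ℓ} (R : CommutativeRing c ℓ) where
  open PowerSeries R public using (seriesRing; shift)
  open PowerSeries R using (conv-zeroˡ; conv-cong; *ₛ-conv)
  private module R = CommutativeRing R
  open CommutativeRing seriesRing hiding (zero)
  open Determinant seriesRing
  open import Algebra.Properties.Ring R.ring using (-0#≈0#)
  open import Algebra.Properties.Ring ring using (x≈y⇒x∙y⁻¹≈ε; x∙y⁻¹≈ε⇒x≈y; -‿distribʳ-*)
  open Relation.Binary.Reasoning.Setoid R.setoid

  Deg≤ : Series R → ℕ → Set ℓ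
  Deg≤ f a = ∀ k → a ℕ.< k → f k R.≈ R.0#

  Monic : Series R → ℕ → Set ℓ
  Monic f a = Deg≤ f a × f a R.≈ R.1#

  Deg≤-cong : ∀ {f g a} → f ≈ g → Deg≤ f a → Deg≤ g a
  Deg≤-cong f≈g f≤a k a<k = R.trans (R.sym (f≈g k)) (f≤a k a<k)

  Deg≤-mono : ∀ {f a b} → a ℕ.≤ b → Deg≤ f a → Deg≤ f b
  Deg≤-mono a≤b f≤a k b<k = f≤a k (ℕ.≤-<-trans a≤b b<k)

  Deg≤-+ : ∀ {f g a} → Deg≤ f a → Deg≤ g a → Deg≤ (f + g) a
  Deg≤-+ f≤a g≤a k a<k = R.trans (R.+-cong (f≤a k a<k) (g≤a k a<k)) (R.+-identityʳ R.0#)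

  Deg≤-‿ : ∀ {f a} → Deg≤ f a → Deg≤ (- f) a
  Deg≤-‿ f≤a k a<k = R.trans (R.-‿cong (f≤a k a<k)) -0#≈0#

  Deg≤-shift : ∀ {f a} → Deg≤ f (suc a) → Deg≤ (shift f) a
  Deg≤-shift f≤1+a k a<k = f≤1+a (suc k) (ℕ.s≤s a<k)

  private
    Deg≤-conv : ∀ a b {f g} → Deg≤ f a → Deg≤ g b → Deg≤ (conv R f g) (a ℕ.+ b)
    Deg≤-conv a       b {f} {g} f≤a g≤b zero    ()
    Deg≤-conv zero    b {f} {g} f≤a g≤b (suc k) b<1+k =
      R.trans (R.+-cong (R.trans (R.*-congˡ (g≤b (suc k) b<1+k)) (R.zeroʳ _))
                        (conv-zeroˡ (shift f) g (λ j → f≤a (suc j) ℕ.z<s) k)) (R.+-identityʳ R.0#)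
    Deg≤-conv (suc a) b {f} {g} f≤a g≤b (suc k) (ℕ.s≤s a+b<k) =
      R.trans (R.+-cong (R.trans (R.*-congˡ (g≤b (suc k) (ℕ.s≤s (ℕ.≤-trans (ℕ.m≤n+m b a) (ℕ.<⇒≤ a+b<k)))))
                                 (R.zeroʳ _))
                        (Deg≤-conv a b (Deg≤-shift f≤a) g≤b k a+b<k)) (R.+-identityʳ R.0#)

    leading-conv : ∀ a b {f g} → Deg≤ f a → Deg≤ g b → conv R f g (a ℕ.+ b) R.≈ f a R.* g b
    leading-conv zero    zero    {f} {g} f≤a g≤b = R.+-identityʳ _
    leading-conv zero    (suc b) {f} {g} f≤a g≤b =
      R.trans (R.+-congˡ (conv-zeroˡ (shift f) g (λ j → f≤a (suc j) ℕ.z<s) b)) (R.+-identityʳ _)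
    leading-conv (suc a) b       {f} {g} f≤a g≤b =
      R.trans (R.+-cong (R.trans (R.*-congˡ (g≤b (suc (a ℕ.+ b)) (ℕ.s≤s (ℕ.m≤n+m b a)))) (R.zeroʳ _))
                        (leading-conv a b (Deg≤-shift f≤a) g≤b)) (R.+-identityˡ _)

  Deg≤-* : ∀ a b {f g} → Deg≤ f a → Deg≤ g b → Deg≤ (f * g) (a ℕ.+ b)
  Deg≤-* a b {f} {g} f≤a g≤b = Deg≤-cong (λ k → R.sym (*ₛ-conv f g k)) (Deg≤-conv a b f≤a g≤b)

  leading-* : ∀ a b {f g} → Deg≤ f a → Deg≤ g b → (f * g) (a ℕ.+ b) R.≈ f a R.* g b
  leading-* a b {f} {g} f≤a g≤b = R.trans (*ₛ-conv f g (a ℕ.+ b)) (leading-conv a b f≤a g≤b)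

  Monic-* : ∀ a b {f g} → Monic f a → Monic g b → Monic (f * g) (a ℕ.+ b)
  Monic-* a b (f≤a , fₐ≈1) (g≤b , g_b≈1) =
    Deg≤-* a b f≤a g≤b , R.trans (leading-* a b f≤a g≤b) (R.trans (R.*-cong fₐ≈1 g_b≈1) (R.*-identityˡ R.1#))

  Monic-1 : Monic 1# 0
  Monic-1 = (λ { (suc k) _ → R.refl }) , R.refl

  Monic-^ : ∀ n m {f} → Monic f m → Monic (f ^ n) (n ℕ.* m)
  Monic-^ zero    m f-monic = Monic-1
  Monic-^ (suc n) m f-monic = Monic-* m (n ℕ.* m) f-monic (Monic-^ n m f-monic)

  Deg≤-altΣ : ∀ n a (f : Fin n → Series R) → (∀ i → Deg≤ (f i) a) → Deg≤ (altΣ n f) a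
  Deg≤-altΣ zero    a f f≤a k a<k = R.refl
  Deg≤-altΣ (suc n) a f f≤a = Deg≤-+ (f≤a zero) (Deg≤-‿ (Deg≤-altΣ n a (λ i → f (suc i)) (λ i → f≤a (suc i))))

  Deg≤-det : ∀ n (M : Matrix n) → (∀ i j → Deg≤ (M i j) 1) → Deg≤ (det n M) n
  Deg≤-det zero    M M≤1 = proj₁ Monic-1
  Deg≤-det (suc n) M M≤1 = Deg≤-altΣ (suc n) (suc n) _ (λ j →
    Deg≤-* 1 n (M≤1 zero j) (Deg≤-det n (minor M j) (λ a b → M≤1 (suc a) (punchIn j b))))

  Monic-det : ∀ n (M : Matrix n) → (∀ i → Monic (M i i) 1) → (∀ i j → i ≢ j → Deg≤ (M i j) 0) → Monic (det n M) n
  Monic-det zero    M diag-monic off≤0 = Monic-1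
  Monic-det (suc n) M diag-monic off≤0 =
    Deg≤-+ (proj₁ leading-monic) (Deg≤-‿ (Deg≤-mono (ℕ.n≤1+n n) rest≤n)) ,
    R.trans (R.+-cong (proj₂ leading-monic) (R.-‿cong (rest≤n (suc n) ℕ.≤-refl)))
            (R.trans (R.+-congˡ -0#≈0#) (R.+-identityʳ _))
    where
    all≤1 : ∀ i j → Deg≤ (M i j) 1
    all≤1 i j with i Fin.≟ j
    ... | yes ≡.refl = proj₁ (diag-monic i)
    ... | no  i≢j    = Deg≤-mono ℕ.z≤n (off≤0 i j i≢j)
    leading-monic : Monic (M zero zero * det n (minor M zero)) (suc n)
    leading-monic = Monic-* 1 n (diag-monic zero)
      (Monic-det n (minor M zero) (λ i → diag-monic (suc i)) (λ i j i≢j → off≤0 (suc i) (suc j) (i≢j ∘ suc-injective)))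
    rest≤n : Deg≤ (altΣ n (λ j → M zero (suc j) * det n (minor M (suc j)))) n
    rest≤n = Deg≤-altΣ n n _ (λ j → Deg≤-* 0 n (off≤0 zero (suc j) (λ ()))
                                     (Deg≤-det n (minor M (suc j)) (λ a b → all≤1 (suc a) (punchIn (suc j) b))))

  private
    Monic-*-annihilator : ∀ e d {p h} → Monic p e → Deg≤ h d → p * h ≈ 0# → h ≈ 0#
    Monic-*-annihilator e d {p} {h} (p≤e , pₑ≈1) h≤d₀ p*h≈0 = vanish d h≤d₀
      where
      -- The top coefficient of p * h is that of h, so h vanishes from the top down.
      top : ∀ d → Deg≤ h d → h d R.≈ R.0#
      top d h≤d = begin
        h d               ≈⟨ R.sym (R.*-identityˡ _) ⟩
        R.1# R.* h d      ≈⟨ R.*-congʳ (R.sym pₑ≈1) ⟩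
        p e R.* h d       ≈⟨ R.sym (leading-* e d p≤e h≤d) ⟩
        (p * h) (e ℕ.+ d) ≈⟨ p*h≈0 (e ℕ.+ d) ⟩
        R.0#              ∎
      vanish : ∀ d → Deg≤ h d → ∀ k → h k R.≈ R.0#
      vanish zero    h≤0 zero    = top zero h≤0
      vanish zero    h≤0 (suc k) = h≤0 (suc k) ℕ.z<s
      vanish (suc d) h≤1+d = vanish d h≤d
        where
        h≤d : Deg≤ h d
        h≤d k d<k with k ℕ.≟ suc d
        ... | yes ≡.refl = top (suc d) h≤1+d
        ... | no  k≢1+d  = h≤1+d k (ℕ.≤∧≢⇒< d<k (k≢1+d ∘ ≡.sym))

  Monic-*-cancelˡ : ∀ e d {p f g} → Monic p e → Deg≤ f d → Deg≤ g d → p * f ≈ p * g → f ≈ g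
  Monic-*-cancelˡ e d {p} {f} {g} p-monic f≤d g≤d p*f≈p*g =
    x∙y⁻¹≈ε⇒x≈y f g (Monic-*-annihilator e d p-monic (Deg≤-+ f≤d (Deg≤-‿ g≤d))
      (trans (distribˡ p f (- g)) (trans (+-congˡ (sym (-‿distribʳ-* p g))) (x≈y⇒x∙y⁻¹≈ε p*f≈p*g))))

  altΣ-SeriesRing : ∀ n (f : Fin n → Series R) → RawDet.altΣ (SeriesRing R) n f ≈ altΣ n f
  altΣ-SeriesRing zero    f = refl
  altΣ-SeriesRing (suc n) f = +-congˡ (-‿cong (altΣ-SeriesRing n (λ i → f (suc i))))

  det-SeriesRing : ∀ N (M : Matrix N) → RawDet.det (SeriesRing R) N M ≈ det N M
  det-SeriesRing zero    M = refl
  det-SeriesRing (suc N) M = trans (altΣ-SeriesRing (suc N) terms) (altΣ-cong (suc N) terms (λ j → M zero j * det N (minor M j))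
    (λ j k → R.trans (conv-cong {f = M zero j} {f′ = M zero j} (λ _ → R.refl) (det-SeriesRing N (minor M j)) k)
                     (R.sym (*ₛ-conv (M zero j) (det N (minor M j)) k))))
    where
    terms : Fin (suc N) → Series R
    terms j = conv R (M zero j) (RawDet.det (SeriesRing R) N (minor M j))

  cst : R.Carrier → Series R
  cst = const R

  cst-cong : ∀ {a b} → a R.≈ b → cst a ≈ cst b
  cst-cong a≈b zero    = a≈b
  cst-cong a≈b (suc k) = R.refl

  cst-*ˡ : ∀ a f → cst a * f ≈ (λ k → a R.* f k)
  cst-*ˡ a f zero    = R.trans (*ₛ-conv (cst a) f 0) (R.+-identityʳ _)
  cst-*ˡ a f (suc k) =
    R.trans (*ₛ-conv (cst a) f (suc k)) (R.trans (R.+-congˡ (conv-zeroˡ (shift (cst a)) f (λ _ → R.refl) k)) (R.+-identityʳ _))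

  cst-+ : ∀ a b → cst (a R.+ b) ≈ cst a + cst b
  cst-+ a b zero    = R.refl
  cst-+ a b (suc k) = R.sym (R.+-identityʳ R.0#)

  cst-* : ∀ a b → cst (a R.* b) ≈ cst a * cst b
  cst-* a b zero    = R.sym (cst-*ˡ a (cst b) zero)
  cst-* a b (suc k) = R.sym (R.trans (cst-*ˡ a (cst b) (suc k)) (R.zeroʳ a))

  cst-‿ : ∀ a → cst (R.- a) ≈ - cst a
  cst-‿ a zero    = R.refl
  cst-‿ a (suc k) = R.sym -0#≈0#

  cst-0 : cst R.0# ≈ 0#
  cst-0 zero    = R.refl
  cst-0 (suc k) = R.refl

  cst-1 : cst R.1# ≈ 1#
  cst-1 zero    = R.refl
  cst-1 (suc k) = R.refl

  X-*-zero : ∀ f → (X R * f) 0 R.≈ R.0#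
  X-*-zero f = R.trans (*ₛ-conv (X R) f 0) (R.trans (R.+-identityʳ _) (R.zeroˡ (f 0)))

  shift-X-* : ∀ f → shift (X R * f) ≈ f
  shift-X-* f k = begin
    (X R * f) (suc k)                                ≈⟨ *ₛ-conv (X R) f (suc k) ⟩
    R.0# R.* f (suc k) R.+ conv R (shift (X R)) f k
      ≈⟨ R.+-cong (R.zeroˡ _) (conv-cong {g = f} {g′ = f} shift-X≈1 (λ _ → R.refl) k) ⟩
    R.0# R.+ conv R 1# f k                           ≈⟨ R.+-identityˡ _ ⟩
    conv R 1# f k                                    ≈⟨ R.sym (*ₛ-conv 1# f k) ⟩
    (1# * f) k                                       ≈⟨ *-identityˡ f k ⟩
    f k                                              ∎
    where
    shift-X≈1 : shift (X R) ≈ 1#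
    shift-X≈1 zero    = R.refl
    shift-X≈1 (suc k) = R.refl

module Homogenization {c ℓ} (R : CommutativeRing c ℓ) (p u : Series R) where
  open Polynomials R
  private module R = CommutativeRing R
  open CommutativeRing seriesRing hiding (zero)
  open Determinant seriesRing
  open import Algebra.Properties.Ring R.ring using () renaming (-1*x≈-x to -1*x≈-x′)
  open import Algebra.Properties.Ring ring using (-1*x≈-x)
  open Algebra.Solver.Ring.NaturalCoefficients.Default commutativeSemiring using (solve; _:+_; _:*_; _:=_)
  open Relation.Binary.Reasoning.Setoid setoid

  -- homogenize N f = Σ_{k ≤ N} fₖ uᵏ pᴺ⁻ᵏ, the degree-N homogenisation of f evaluated at (u, p).
  homogenize : ℕ → Series R → Series R
  homogenize zero    f = cst (f 0)
  homogenize (suc N) f = cst (f 0) * p ^ suc N + u * homogenize N (shift f)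

  homogenize-cong : ∀ N {f g} → f ≈ g → homogenize N f ≈ homogenize N g
  homogenize-cong zero    f≈g = cst-cong (f≈g 0)
  homogenize-cong (suc N) f≈g = +-cong (*-congʳ (cst-cong (f≈g 0))) (*-congˡ (homogenize-cong N (λ k → f≈g (suc k))))

  homogenize-+ : ∀ N f g → homogenize N (f + g) ≈ homogenize N f + homogenize N g
  homogenize-+ zero    f g = cst-+ (f 0) (g 0)
  homogenize-+ (suc N) f g = trans
    (+-cong (*-congʳ (cst-+ (f 0) (g 0))) (*-congˡ (homogenize-+ N (shift f) (shift g))))
    (regroup (cst (f 0)) (cst (g 0)) (p ^ suc N) u (homogenize N (shift f)) (homogenize N (shift g)))
    where
    regroup : ∀ a b q v x y → (a + b) * q + v * (x + y) ≈ (a * q + v * x) + (b * q + v * y)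
    regroup = solve 6 (λ a b q v x y → (a :+ b) :* q :+ v :* (x :+ y) := (a :* q :+ v :* x) :+ (b :* q :+ v :* y)) refl

  homogenize-scalar : ∀ N a f → homogenize N (λ k → a R.* f k) ≈ cst a * homogenize N f
  homogenize-scalar zero    a f = cst-* a (f 0)
  homogenize-scalar (suc N) a f = trans
    (+-cong (*-congʳ (cst-* a (f 0))) (*-congˡ (homogenize-scalar N a (shift f))))
    (factor (cst a) (cst (f 0)) (p ^ suc N) u (homogenize N (shift f)))
    where
    factor : ∀ a b q v x → (a * b) * q + v * (a * x) ≈ a * (b * q + v * x)
    factor = solve 5 (λ a b q v x → (a :* b) :* q :+ v :* (a :* x) := a :* (b :* q :+ v :* x)) refl

  homogenize-‿ : ∀ N f → homogenize N (- f) ≈ - homogenize N f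
  homogenize-‿ N f = begin
    homogenize N (- f)                    ≈⟨ homogenize-cong N (λ k → R.sym (-1*x≈-x′ (f k))) ⟩
    homogenize N (λ k → R.- R.1# R.* f k) ≈⟨ homogenize-scalar N (R.- R.1#) f ⟩
    cst (R.- R.1#) * homogenize N f       ≈⟨ *-congʳ (trans (cst-‿ R.1#) (-‿cong cst-1)) ⟩
    - 1# * homogenize N f                 ≈⟨ -1*x≈-x (homogenize N f) ⟩
    - homogenize N f                      ∎

  homogenize-0 : ∀ N → homogenize N 0# ≈ 0#
  homogenize-0 zero    = cst-0
  homogenize-0 (suc N) =
    trans (+-cong (trans (*-congʳ cst-0) (zeroˡ _)) (trans (*-congˡ (homogenize-0 N)) (zeroʳ u))) (+-identityʳ 0#)

  homogenize-altΣ : ∀ N n (f : Fin n → Series R) → homogenize N (altΣ n f) ≈ altΣ n (λ i → homogenize N (f i))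
  homogenize-altΣ N zero    f = homogenize-0 N
  homogenize-altΣ N (suc n) f = trans (homogenize-+ N (f zero) _)
    (+-congˡ (trans (homogenize-‿ N _) (-‿cong (homogenize-altΣ N n (λ i → f (suc i))))))

  homogenize-suc : ∀ N f → Deg≤ f N → homogenize (suc N) f ≈ p * homogenize N f
  homogenize-suc zero    f f≤0 = begin
    cst (f 0) * (p * 1#) + u * cst (f 1) ≈⟨ +-cong (*-congˡ (*-identityʳ p)) (*-congˡ (trans (cst-cong (f≤0 1 ℕ.z<s)) cst-0)) ⟩
    cst (f 0) * p + u * 0#               ≈⟨ trans (+-cong (*-comm _ p) (zeroʳ u)) (+-identityʳ _) ⟩
    p * cst (f 0)                        ∎
  homogenize-suc (suc N) f f≤1+N = trans
    (+-congˡ (*-congˡ (homogenize-suc N (shift f) (Deg≤-shift f≤1+N))))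
    (factor (cst (f 0)) p (p ^ suc N) u (homogenize N (shift f)))
    where
    factor : ∀ a p q v x → a * (p * q) + v * (p * x) ≈ p * (a * q + v * x)
    factor = solve 5 (λ a p q v x → a :* (p :* q) :+ v :* (p :* x) := p :* (a :* q :+ v :* x)) refl

  homogenize-X-* : ∀ N f → homogenize (suc N) (X R * f) ≈ u * homogenize N f
  homogenize-X-* N f = trans
    (+-cong (trans (*-congʳ (trans (cst-cong (X-*-zero f)) cst-0)) (zeroˡ _)) (*-congˡ (homogenize-cong N (shift-X-* f))))
    (+-identityˡ _)

  homogenize-linear-* : ∀ N e g → Deg≤ e 1 → Deg≤ g N →
    homogenize (suc N) (e * g) ≈ (cst (e 0) * p + cst (e 1) * u) * homogenize N g
  homogenize-linear-* N e g e≤1 g≤N = begin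
    homogenize (suc N) (e * g)
      ≈⟨ homogenize-cong (suc N) (trans (*-congʳ e≈a+bX)
           (trans (distribʳ g _ _) (+-cong (cst-*ˡ (e 0) g) (trans (*-assoc _ _ _) (cst-*ˡ (e 1) _))))) ⟩
    homogenize (suc N) ((λ k → e 0 R.* g k) + (λ k → e 1 R.* (X R * g) k))
      ≈⟨ trans (homogenize-+ (suc N) (λ k → e 0 R.* g k) (λ k → e 1 R.* (X R * g) k))
               (+-cong (homogenize-scalar (suc N) (e 0) g) (homogenize-scalar (suc N) (e 1) (X R * g))) ⟩
    cst (e 0) * homogenize (suc N) g + cst (e 1) * homogenize (suc N) (X R * g)
      ≈⟨ +-cong (*-congˡ (homogenize-suc N g g≤N)) (*-congˡ (homogenize-X-* N g)) ⟩
    cst (e 0) * (p * homogenize N g) + cst (e 1) * (u * homogenize N g)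
      ≈⟨ factor (cst (e 0)) p (cst (e 1)) u (homogenize N g) ⟩
    (cst (e 0) * p + cst (e 1) * u) * homogenize N g ∎
    where
    factor : ∀ a p b v x → a * (p * x) + b * (v * x) ≈ (a * p + b * v) * x
    factor = solve 5 (λ a p b v x → a :* (p :* x) :+ b :* (v :* x) := (a :* p :+ b :* v) :* x) refl
    e≈a+bX : e ≈ cst (e 0) + cst (e 1) * X R
    e≈a+bX zero                = R.sym (R.trans (R.+-congˡ (R.trans (cst-*ˡ (e 1) (X R) zero) (R.zeroʳ _))) (R.+-identityʳ _))
    e≈a+bX (suc zero)          = R.sym (R.trans (R.+-identityˡ _) (R.trans (cst-*ˡ (e 1) (X R) 1) (R.*-identityʳ _)))
    e≈a+bX (suc (suc k))       = R.trans (e≤1 (suc (suc k)) (ℕ.s≤s ℕ.z<s))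
                                         (R.sym (R.trans (R.+-identityˡ _) (R.trans (cst-*ˡ (e 1) (X R) (suc (suc k))) (R.zeroʳ _))))

  homogenized : ∀ {N} → Matrix N → Matrix N
  homogenized E i j = cst (E i j 0) * p + cst (E i j 1) * u

  homogenize-det : ∀ N (E : Matrix N) → (∀ i j → Deg≤ (E i j) 1) → homogenize N (det N E) ≈ det N (homogenized E)
  homogenize-det zero    E E≤1 = cst-1
  homogenize-det (suc N) E E≤1 = begin
    homogenize (suc N) (altΣ (suc N) (λ j → E zero j * det N (minor E j)))
      ≈⟨ homogenize-altΣ (suc N) (suc N) (λ j → E zero j * det N (minor E j)) ⟩
    altΣ (suc N) (λ j → homogenize (suc N) (E zero j * det N (minor E j)))
      ≈⟨ altΣ-cong (suc N) _ (λ j → homogenized E zero j * det N (minor (homogenized E) j)) (λ j →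
           trans (homogenize-linear-* N (E zero j) _ (E≤1 zero j) (Deg≤-det N (minor E j) (minor-≤1 j)))
                 (*-congˡ (homogenize-det N (minor E j) (minor-≤1 j)))) ⟩
    det (suc N) (homogenized E) ∎
    where
    minor-≤1 : ∀ j a b → Deg≤ (minor E j a b) 1
    minor-≤1 j a b = E≤1 (suc a) (punchIn j b)

Σℕ-cong : ∀ n {f g : Fin n → ℕ} → (∀ i → f i ≡ g i) → Σℕ n f ≡ Σℕ n g
Σℕ-cong zero    f≡g = ≡.refl
Σℕ-cong (suc n) f≡g = ≡.cong₂ ℕ._+_ (f≡g zero) (Σℕ-cong n (λ i → f≡g (suc i)))

Σℕ-zero : ∀ n {f : Fin n → ℕ} → (∀ i → f i ≡ 0) → Σℕ n f ≡ 0
Σℕ-zero zero    f≡0 = ≡.refl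
Σℕ-zero (suc n) f≡0 = ≡.cong₂ ℕ._+_ (f≡0 zero) (Σℕ-zero n (λ i → f≡0 (suc i)))

Σℕ-splitAt : ∀ a b (f : Fin (a ℕ.+ b) → ℕ) →
       Σℕ (a ℕ.+ b) f ≡ Σℕ a (λ i → f (i ↑ˡ b)) ℕ.+ Σℕ b (λ j → f (a ↑ʳ j))
Σℕ-splitAt zero    b f = ≡.refl
Σℕ-splitAt (suc a) b f = ≡.trans (≡.cong (f zero ℕ.+_) (Σℕ-splitAt a b (λ i → f (suc i)))) (≡.sym (ℕ.+-assoc (f zero) _ _))

Σℕ-combine : ∀ n m (f : Fin (n ℕ.* m) → ℕ) → Σℕ (n ℕ.* m) f ≡ Σℕ n (λ v → Σℕ m (λ k → f (combine v k)))
Σℕ-combine zero    m f = ≡.refl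
Σℕ-combine (suc n) m f =
  ≡.trans (Σℕ-splitAt m (n ℕ.* m) f) (≡.cong (Σℕ m (λ k → f (k ↑ˡ (n ℕ.* m))) ℕ.+_) (Σℕ-combine n m (λ j → f (m ↑ʳ j))))

Σℕ-vertexIndex : ∀ n m (f : Fin (n ℕ.+ n ℕ.* m) → ℕ) →
  Σℕ (n ℕ.+ n ℕ.* m) f ≡ Σℕ n (λ w → f (vertexIndex (base w))) ℕ.+ Σℕ n (λ w → Σℕ m (λ l → f (vertexIndex (copy w l))))
Σℕ-vertexIndex n m f =
  ≡.trans (Σℕ-splitAt n (n ℕ.* m) f) (≡.cong (Σℕ n (λ w → f (vertexIndex (base w))) ℕ.+_) (Σℕ-combine n m (λ j → f (n ↑ʳ j))))

Σℕ-eqF : ∀ n (v : Fin n) (F : Bool → Fin n → ℕ) → (∀ w → F false w ≡ 0) →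
         Σℕ n (λ w → F (eqF v w) w) ≡ F true v
Σℕ-eqF (suc n) zero    F F-false≡0 =
  ≡.trans (≡.cong (F true zero ℕ.+_) (Σℕ-zero n (λ i → F-false≡0 (suc i)))) (ℕ.+-identityʳ _)
Σℕ-eqF (suc n) (suc v) F F-false≡0 = ≡.trans
  (≡.cong₂ ℕ._+_ (F-false≡0 zero) (Σℕ-cong n (λ w → ≡.cong (λ b → F b (suc w)) (eqF-injective suc-injective v w))))
  (Σℕ-eqF n v (λ b w → F b (suc w)) (λ w → F-false≡0 (suc w)))

rootDegree : ∀ {m} → Graph (suc m) → ℕ
rootDegree {m} H = Σℕ m (λ l → boolToℕ (H zero (suc l)))

module _ {n m : ℕ} (G : Graph n) (H : Graph (suc m)) where

  coalesce-vertexIndex : ∀ x y → coalesce G H (vertexIndex x) (vertexIndex y) ≡ adjC G H x y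
  coalesce-vertexIndex x y rewrite classify-vertexIndex x | classify-vertexIndex y = ≡.refl

  private
    deg-vertexIndex : ∀ x → deg (coalesce G H) (vertexIndex x) ≡
      Σℕ n (λ w → boolToℕ (adjC G H x (base w))) ℕ.+ Σℕ n (λ w → Σℕ m (λ l → boolToℕ (adjC G H x (copy w l))))
    deg-vertexIndex x = ≡.trans (Σℕ-vertexIndex n m _) (≡.cong₂ ℕ._+_
      (Σℕ-cong n (λ w → ≡.cong boolToℕ (coalesce-vertexIndex x (base w))))
      (Σℕ-cong n (λ w → Σℕ-cong m (λ l → ≡.cong boolToℕ (coalesce-vertexIndex x (copy w l))))))

  deg-coalesce-base : ∀ v → deg (coalesce G H) (vertexIndex (base v)) ≡ deg G v ℕ.+ rootDegree H
  deg-coalesce-base v = ≡.trans (deg-vertexIndex (base v))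
    (≡.cong (deg G v ℕ.+_)
            (Σℕ-eqF n v (λ b w → Σℕ m (λ l → boolToℕ (b ∧ H zero (suc l)))) (λ w → Σℕ-zero m (λ l → ≡.refl))))

  deg-coalesce-copy : ∀ v k → deg (coalesce G H) (vertexIndex (copy v k)) ≡ deg H (suc k)
  deg-coalesce-copy v k = ≡.trans (deg-vertexIndex (copy v k)) (≡.cong₂ ℕ._+_
    (Σℕ-eqF n v (λ b w → boolToℕ (b ∧ H (suc k) zero)) (λ w → ≡.refl))
    (Σℕ-eqF n v (λ b w → Σℕ m (λ l → boolToℕ (b ∧ H (suc k) (suc l)))) (λ w → Σℕ-zero m (λ l → ≡.refl))))

module CharacteristicMatrix {c ℓ} (R : CommutativeRing c ℓ) where
  private module R = CommutativeRing R
  open Polynomials R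
  open CommutativeRing seriesRing hiding (zero)
  open Determinant seriesRing
  open Algebra.Properties.Ring R.ring using (-0#≈0#)

  charEntry : Bool → R.Carrier → Series R
  charEntry b a = if b then (λ k → X R k R.+ R.- const R a k) else (λ k → R.- const R a k)

  charMatrix : ∀ {N} → (Fin N → Fin N → R.Carrier) → Matrix N
  charMatrix M i j = charEntry (eqF i j) (M i j)

  charPoly≈det : ∀ N M → charPoly R N M ≈ det N (charMatrix M)
  charPoly≈det N M = det-SeriesRing N (charMatrix M)

  charEntry-Deg≤1 : ∀ b a → Deg≤ (charEntry b a) 1
  charEntry-Deg≤1 b     a (suc zero)    (ℕ.s≤s ())
  charEntry-Deg≤1 true  a (suc (suc k)) _ = R.trans (R.+-congˡ -0#≈0#) (R.+-identityʳ _)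
  charEntry-Deg≤1 false a (suc (suc k)) _ = -0#≈0#

  charEntry-false-Deg≤0 : ∀ a → Deg≤ (charEntry false a) 0
  charEntry-false-Deg≤0 a (suc k) _ = -0#≈0#

  charEntry-true-Monic : ∀ a → Monic (charEntry true a) 1
  charEntry-true-Monic a = charEntry-Deg≤1 true a , R.trans (R.+-congˡ -0#≈0#) (R.+-identityʳ _)

  Monic-det-charMatrix : ∀ N M → Monic (det N (charMatrix M)) N
  Monic-det-charMatrix N M = Monic-det N (charMatrix M)
    (λ i → ≡.subst (λ b → Monic (charEntry b (M i i)) 1) (≡.sym (eqF-refl i)) (charEntry-true-Monic (M i i)))
    (λ i j i≢j → ≡.subst (λ b → Deg≤ (charEntry b (M i j)) 0) (≡.sym (eqF-≢ i≢j)) (charEntry-false-Deg≤0 (M i j)))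

  charPoly-Deg≤ : ∀ N M → Deg≤ (charPoly R N M) N
  charPoly-Deg≤ N M = Deg≤-cong (sym (charPoly≈det N M)) (proj₁ (Monic-det-charMatrix N M))

  cst-charEntry₀ : ∀ b a → cst (charEntry b a 0) ≈ - cst a
  cst-charEntry₀ true  a = trans (cst-cong (R.+-identityˡ _)) (cst-‿ a)
  cst-charEntry₀ false a = cst-‿ a

  cst-charEntry₁ : ∀ b a → cst (charEntry b a 1) ≈ (if b then 1# else 0#)
  cst-charEntry₁ true  a = trans (cst-cong (R.trans (R.+-congˡ -0#≈0#) (R.+-identityʳ _))) cst-1
  cst-charEntry₁ false a = trans (cst-cong -0#≈0#) cst-0

module Coalescence {c ℓ} (R : CommutativeRing c ℓ) (q : CommutativeRing.Carrier R) {m : ℕ} (H : Graph (suc m)) where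
  private module R = CommutativeRing R
  open Polynomials R
  open CommutativeRing seriesRing hiding (zero)
  open Determinant seriesRing
  open CharacteristicMatrix R
  open Algebra.Properties.Ring R.ring using (-0#≈0#)
  open Algebra.Solver.Ring.NaturalCoefficients.Default commutativeSemiring using (solve; _:+_; _:*_; _:=_)
  open Relation.Binary.Reasoning.Setoid setoid

  -- The characteristic matrix of L_H, partitioned at the root:  xI − L_H = [[∗, βᵀ], [γ, P]].
  P : Matrix m
  P = charMatrix (λ k l → qLaplacian R q H (suc k) (suc l))

  β γ : Fin m → Series R
  β l = charMatrix (qLaplacian R q H) zero (suc l)
  γ k = charMatrix (qLaplacian R q H) (suc k) zero

  p s rootShift u : Series R
  p = det m P
  s = altΣ m (λ l → cramerVector P γ l * β l)
  rootShift = cst (q R.* fromℕ R (rootDegree H))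
  u = p * (X R + - rootShift) + - s

  baseBlock : ∀ {n} → Graph n → Matrix n
  baseBlock G v w = charMatrix (qLaplacian R q G) v w + - (if eqF v w then rootShift else 0#)

  private
    laplacianEntry : Bool → ℕ → Bool → Series R
    laplacianEntry b d e = charEntry b (if b then q R.* fromℕ R d else (if e then R.1# else R.0#))

    fromℕ-+ : ∀ a b → fromℕ R (a ℕ.+ b) R.≈ fromℕ R a R.+ fromℕ R b
    fromℕ-+ zero    b = R.sym (R.+-identityˡ _)
    fromℕ-+ (suc a) b = R.trans (R.+-congˡ (fromℕ-+ a b)) (R.sym (R.+-assoc _ _ _))

    laplacianEntry-shift : ∀ b d e →
      laplacianEntry b (d ℕ.+ rootDegree H) e ≈ laplacianEntry b d e + - (if b then rootShift else 0#)
    laplacianEntry-shift true  d e = begin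
      X R + - cst (q R.* fromℕ R (d ℕ.+ rootDegree H))
        ≈⟨ +-congˡ (-‿cong (trans (cst-cong (R.trans (R.*-congˡ (fromℕ-+ d _)) (R.distribˡ q _ _))) (cst-+ _ _))) ⟩
      X R + - (cst (q R.* fromℕ R d) + rootShift) ≈⟨ +-congˡ (sym (-‿+-comm _ _)) ⟩
      X R + (- cst (q R.* fromℕ R d) + - rootShift) ≈⟨ sym (+-assoc _ _ _) ⟩
      (X R + - cst (q R.* fromℕ R d)) + - rootShift ∎
      where open Algebra.Properties.Ring ring using (-‿+-comm)
    laplacianEntry-shift false d e = sym (x-0≈x _)

    laplacianEntry-∧ : ∀ b d d′ e → laplacianEntry false d (b ∧ e) ≈ (if b then laplacianEntry false d′ e else 0#)
    laplacianEntry-∧ true  d d′ e = refl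
    laplacianEntry-∧ false d d′ e k = R.trans (R.-‿cong (cst-0 k)) -0#≈0#

    eqF-vertexIndex-≢ : ∀ {n} {x y : CVert n m} → x ≢ y → eqF (vertexIndex x) (vertexIndex y) ≡ false
    eqF-vertexIndex-≢ x≢y = eqF-≢ (x≢y ∘ vertexIndex-injective)

  module _ {n : ℕ} (G : Graph n) where
    private
      C = coalesce G H

      entryAt : CVert n m → CVert n m → Series R
      entryAt x y = laplacianEntry (eqF (vertexIndex x) (vertexIndex y)) (deg C (vertexIndex x)) (adjC G H x y)

      entry : ∀ x y → charMatrix (qLaplacian R q C) (vertexIndex x) (vertexIndex y) ≈ entryAt x y
      entry x y = reflexive (≡.cong (laplacianEntry (eqF (vertexIndex x) (vertexIndex y)) (deg C (vertexIndex x)))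
                                    (coalesce-vertexIndex G H x y))

      base-base : ∀ v w → entryAt (base v) (base w) ≈ baseBlock G v w
      base-base v w
        rewrite eqF-injective {f = vertexIndex ∘ base} (λ eq → base-injective (vertexIndex-injective {n} {m} eq)) v w
              | deg-coalesce-base G H v
        = laplacianEntry-shift (eqF v w) (deg G v) (G v w)

      base-copy : ∀ v w l → entryAt (base v) (copy w l) ≈ (if eqF v w then β l else 0#)
      base-copy v w l rewrite eqF-vertexIndex-≢ {x = base v} {y = copy w l} (λ ()) =
        laplacianEntry-∧ (eqF v w) (deg C (vertexIndex (base v))) (deg H zero) (H zero (suc l))

      copy-base : ∀ v k w → entryAt (copy v k) (base w) ≈ (if eqF v w then γ k else 0#)
      copy-base v k w rewrite eqF-vertexIndex-≢ {x = copy v k} {y = base w} (λ ()) =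
        laplacianEntry-∧ (eqF v w) (deg C (vertexIndex (copy v k))) (deg H (suc k)) (H (suc k) zero)

      copy-copy : ∀ v k w l → Dec (v ≡ w) → entryAt (copy v k) (copy w l) ≈ (if eqF v w then P k l else 0#)
      copy-copy v k v l (yes ≡.refl)
        rewrite eqF-injective {f = vertexIndex ∘ copy v} (λ eq → copy-injectiveʳ (vertexIndex-injective {n} {m} eq)) k l
              | deg-coalesce-copy G H v k | eqF-refl v | eqF-injective suc-injective k l
        = refl
      copy-copy v k w l (no v≢w)
        rewrite eqF-vertexIndex-≢ {x = copy v k} {y = copy w l} (v≢w ∘ copy-injectiveˡ) | eqF-≢ v≢w
        = laplacianEntry-∧ false (deg C (vertexIndex (copy v k))) (deg H (suc k)) (H (suc k) (suc l))

    charMatrix-coalesce-vertexIndex : ∀ x y → charMatrix (qLaplacian R q (coalesce G H)) (vertexIndex x) (vertexIndex y) ≈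
                                              blockEntry (baseBlock G) β γ P x y
    charMatrix-coalesce-vertexIndex (base v)   (base w)   = trans (entry (base v) (base w)) (base-base v w)
    charMatrix-coalesce-vertexIndex (base v)   (copy w l) = trans (entry (base v) (copy w l)) (base-copy v w l)
    charMatrix-coalesce-vertexIndex (copy v k) (base w)   = trans (entry (copy v k) (base w)) (copy-base v k w)
    charMatrix-coalesce-vertexIndex (copy v k) (copy w l) = trans (entry (copy v k) (copy w l)) (copy-copy v k w l (v ≟ w))

    charMatrix-coalesce : ∀ i j → charMatrix (qLaplacian R q (coalesce G H)) i j ≈ blockMatrix (baseBlock G) β γ P i j
    charMatrix-coalesce i j =
      ≡.subst₂ (λ i j → charMatrix (qLaplacian R q (coalesce G H)) i j ≈ blockMatrix (baseBlock G) β γ P i j)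
               (vertexIndex-classify {n} {m} i) (vertexIndex-classify {n} {m} j)
               (trans (charMatrix-coalesce-vertexIndex x y) (sym (blockMatrix-vertexIndex (baseBlock G) β γ P x y)))
      where
      x = classify i
      y = classify j

  private
    rearrange : ∀ p x a b c → p * ((x + a) + b) + c ≈ a * p + (p * (x + b) + c)
    rearrange = solve 5 (λ p x a b c → p :* ((x :+ a) :+ b) :+ c := a :* p :+ (p :* (x :+ b) :+ c)) refl

    schurEntry : ∀ b a → p * (charEntry b a + - (if b then rootShift else 0#)) + - (if b then s else 0#) ≈
                         cst (charEntry b a 0) * p + cst (charEntry b a 1) * u
    schurEntry true  a = begin
      p * ((X R + - cst a) + - rootShift) + - s  ≈⟨ rearrange p (X R) (- cst a) (- rootShift) (- s) ⟩
      - cst a * p + u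
        ≈⟨ sym (+-cong (*-congʳ (cst-charEntry₀ true a)) (trans (*-congʳ (cst-charEntry₁ true a)) (*-identityˡ u))) ⟩
      cst (charEntry true a 0) * p + cst (charEntry true a 1) * u ∎
    schurEntry false a = begin
      p * (- cst a + - 0#) + - 0#
        ≈⟨ trans (x-0≈x _) (trans (*-congˡ (x-0≈x _)) (*-comm p _)) ⟩
      - cst a * p
        ≈⟨ sym (trans (+-cong (*-congʳ (cst-charEntry₀ false a)) (trans (*-congʳ (cst-charEntry₁ false a)) (zeroˡ u)))
                      (+-identityʳ _)) ⟩
      cst (charEntry false a 0) * p + cst (charEntry false a 1) * u ∎

  open Homogenization R p u using (homogenize; homogenized; homogenize-cong; homogenize-det)

  p^n*charPoly-coalesce : ∀ {n} (G : Graph n) →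
    p ^ n * charPoly R (n ℕ.+ n ℕ.* m) (qLaplacian R q (coalesce G H)) ≈ homogenize n (charPoly R n (qLaplacian R q G)) * p ^ n
  p^n*charPoly-coalesce {n} G = begin
    p ^ n * charPoly R (n ℕ.+ n ℕ.* m) (qLaplacian R q (coalesce G H))
      ≈⟨ *-congˡ (trans (charPoly≈det _ (qLaplacian R q (coalesce G H))) (det-cong _ _ _ (charMatrix-coalesce G))) ⟩
    p ^ n * det (n ℕ.+ n ℕ.* m) (blockMatrix (baseBlock G) β γ P)
      ≈⟨ det-blockMatrix n m (baseBlock G) β γ P ⟩
    det n (scaledSchurComplement (baseBlock G) β γ P) * p ^ n
      ≈⟨ *-congʳ (det-cong n _ _ (λ v w → schurEntry (eqF v w) (qLaplacian R q G v w))) ⟩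
    det n (homogenized (charMatrix (qLaplacian R q G))) * p ^ n
      ≈⟨ *-congʳ (sym (trans (homogenize-cong n (charPoly≈det n (qLaplacian R q G)))
                             (homogenize-det n _ (λ i j → charEntry-Deg≤1 (eqF i j) (qLaplacian R q G i j))))) ⟩
    homogenize n (charPoly R n (qLaplacian R q G)) * p ^ n ∎

  p-Monic : Monic p m
  p-Monic = Monic-det-charMatrix m (λ k l → qLaplacian R q H (suc k) (suc l))

proposition4p6 : ∀ {c ℓ} (R : CommutativeRing c ℓ) (q : CommutativeRing.Carrier R)
                 (n m : ℕ) (G₁ G₂ : Graph n) (H : Graph (suc m)) →
                 IsSimple G₁ → IsSimple G₂ → IsSimple H →
                 QCospectral R q G₁ G₂ →
                 QCospectral R q (coalesce G₁ H) (coalesce G₂ H)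
proposition4p6 R q n m G₁ G₂ H _ _ _ χG₁≈χG₂ =
  Monic-*-cancelˡ (n ℕ.* m) (n ℕ.+ n ℕ.* m) (Monic-^ n m p-Monic) (χ-Deg≤ (coalesce G₁ H)) (χ-Deg≤ (coalesce G₂ H))
  (begin
    p ^ n * χ (coalesce G₁ H)    ≈⟨ p^n*charPoly-coalesce G₁ ⟩
    homogenize n (χ G₁) * p ^ n  ≈⟨ *-congʳ (homogenize-cong n χG₁≈χG₂) ⟩
    homogenize n (χ G₂) * p ^ n  ≈⟨ sym (p^n*charPoly-coalesce G₂) ⟩
    p ^ n * χ (coalesce G₂ H)    ∎)
  where
  open Polynomials R
  open CommutativeRing seriesRing hiding (zero)
  open Determinant seriesRing using (_^_)
  open CharacteristicMatrix R using (charPoly-Deg≤)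
  open Coalescence R q H
  open Homogenization R p u using (homogenize; homogenize-cong)
  open Relation.Binary.Reasoning.Setoid setoid

  χ : ∀ {N} → Graph N → Series R
  χ {N} G = charPoly R N (qLaplacian R q G)

  χ-Deg≤ : ∀ {N} (G : Graph N) → Deg≤ (χ G) N
  χ-Deg≤ {N} G = charPoly-Deg≤ N (qLaplacian R q G)
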